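{- Let $k\mid n$, let $\lambda\vdash n$ have empty $k$-core, let $B\in\mathrm{BST}(\lambda,k)$ and let $\mathcal{T}=(T^0,\dots,T^{k-1})$ be the standard Young tableau tuple corresponding to $B$ under the Littlewood quotient map. Then $\mathrm{DES}(B)=\mathrm{DES}(\mathcal{T})$. Moreover, if $s$ is the index of the diagram of $\mathcal T$ containing $1$ and $B^1$ is the strip of $B$ containing $1$, then $\mathrm{ht}(B^1)=k-1-s$.
   Context: English notation; content of a cell = column index minus row index. A border strip is a connected skew shape with no $2\times2$ square; its tail is its cell of smallest content; its height is the number of rows it spans minus one. $\mathrm{BST}(\lambda,k)$ is the set of fillings of $\lambda$ with $\{1,\dots,n/k\}$, weakly increasing along rows and columns, such that the cells containing $i$ form a border strip $B^i$ of size $k$ for each $i$. For $B\in\mathrm{BST}(\lambda,k)$ with $x_i$ the tail of $B^i$, $i$ is a descent if $x_{i+1}$ is in a strictly lower row than $x_i$; $\mathrm{DES}(B)$ is the descent set. The $k$-core: what remains after removing size-$k$ border strips as long as possible. The $k$-quotient of a partition: append zero rows so the number of rows is divisible by $k$, encode the lower-right boundary as a word $w_0w_1\cdots$ from bottom-left to top-right ($0$ north step, $1$ east step); $\lambda^s$ is the partition with boundary word $w_sw_{s+k}w_{s+2k}\cdots$, $0\le s<k$. A standard Young tableau tuple of shapes $\Lambda=(\lambda^0,\dots,\lambda^{k-1})$ is a bijective filling of all cells of $\Lambda$ with $1,\dots,|\Lambda|$ strictly increasing along rows and columns of each diagram. Littlewood quotient map: view $B$ as the flag $\emptyset=\nu_0\subset\nu_1\subset\dots\subset\nu_{n/k}=\lambda$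 where $\nu_i$ consists of the cells with labels $\le i$; each $\nu_i$ has empty $k$-core and the $k$-quotient $\Lambda_i$ of $\nu_i$ is obtained from $\Lambda_{i-1}$ by adding exactly one cell $x_i$ (a known fact); filling $x_i$ with $i$ gives a standard Young tableau tuple of shapes the $k$-quotient of $\lambda$. Descents of a tuple $\mathcal{T}=(T^0,\dots,T^{k-1})$: with $c(j)$ the content of the cell containing $j$ within its own diagram, and $i\in T^s$, $i+1\in T^t$, $i$ is a descent if either $s\le t$ and $c(i)>c(i+1)$, or $s>t$ and $c(i)\ge c(i+1)$; $\mathrm{DES}(\mathcal T)$ is the set of descents. -}

module Defs where

open import Data.Bool using (Bool; true; false; if_then_else_)
open import Data.Nat using (ℕ; zero; suc; _+_; _*_; _∸_; _≤_; _<_; _<ᵇ_; _≤ᵇ_)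
open import Data.Integer as ℤ using (ℤ; +_)
open import Data.List using (List; []; _∷_; length; reverse; replicate; _++_)
open import Data.List.Relation.Unary.All using (All)
open import Data.List.Relation.Unary.Linked using (Linked)
open import Data.List.Relation.Unary.Unique.Propositional using (Unique)
open import Data.List.Membership.Propositional using (_∈_)
open import Data.Product using (Σ; ∃; _×_; _,_; proj₁; proj₂)
open import Data.Sum using (_⊎_)
open import Relation.Nullary using (¬_)
open import Relation.Binary.PropositionalEquality using (_≡_)
open import Function.Bundles using (_⇔_)

-- a cell is (row , column); row 0 is the top row
Cell : Set
Cell = ℕ × ℕ

row : Cell → ℕ
row = proj₁

col : Cell → ℕ
col = proj₂

content : Cell → ℤ
content (r , c) = (+ c) ℤ.- (+ r)

IsPartition : List ℕ → Set
IsPartition μ = Linked (λ a b → b ≤ a) μ × All (λ a → 0 < a) μ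

rowLen : List ℕ → ℕ → ℕ
rowLen []       r       = 0
rowLen (x ∷ xs) zero    = x
rowLen (x ∷ xs) (suc r) = rowLen xs r

InShape : List ℕ → Cell → Set
InShape μ (r , c) = c < rowLen μ r

inShapeᵇ : List ℕ → Cell → Bool
inShapeᵇ μ (r , c) = c <ᵇ rowLen μ r

CellSet : Set₁
CellSet = Cell → Set

HasSize : CellSet → ℕ → Set
HasSize S k = Σ (List Cell) λ xs → Unique xs × (∀ x → (x ∈ xs) ⇔ S x) × length xs ≡ k

Adj : Cell → Cell → Set
Adj (r , c) (r' , c') =
  (r ≡ r' × suc c ≡ c') ⊎ (r ≡ r' × c ≡ suc c') ⊎
  (c ≡ c' × suc r ≡ r') ⊎ (c ≡ c' × r ≡ suc r')

data Path (S : CellSet) : Cell → Cell → Set where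
  here : ∀ {a} → Path S a a
  step : ∀ {a b c} → Adj a b → S b → Path S b c → Path S a c

Connected : CellSet → Set
Connected S = ∀ a b → S a → S b → Path S a b

-- skew shape: convex w.r.t. the componentwise order on cells
IsSkewShape : CellSet → Set
IsSkewShape S = ∀ r₁ c₁ r₂ c₂ r c → S (r₁ , c₁) → S (r₂ , c₂) →
  r₁ ≤ r → r ≤ r₂ → c₁ ≤ c → c ≤ c₂ → S (r , c)

No2x2 : CellSet → Set
No2x2 S = ∀ r c → ¬ (S (r , c) × S (r , suc c) × S (suc r , c) × S (suc r , suc c))

IsBorderStrip : CellSet → ℕ → Set
IsBorderStrip S k = IsSkewShape S × Connected S × No2x2 S × HasSize S k

IsTail : CellSet → Cell → Set
IsTail S x = S x × (∀ y → S y → content x ℤ.≤ content y)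

-- height: (number of rows spanned) minus one, i.e. S spans exactly h+1 rows
HasHeight : CellSet → ℕ → Set
HasHeight S h = Σ (List ℕ) λ rs → Unique rs × (∀ r → (r ∈ rs) ⇔ (∃ λ c → S (r , c))) × length rs ≡ suc h

Skew : List ℕ → List ℕ → CellSet
Skew ν μ x = InShape ν x × ¬ InShape μ x

SubShape : List ℕ → List ℕ → Set
SubShape μ ν = ∀ x → InShape μ x → InShape ν x

RemoveStrip : ℕ → List ℕ → List ℕ → Set
RemoveStrip k ν μ = IsPartition μ × SubShape μ ν × IsBorderStrip (Skew ν μ) k

data Reduces (k : ℕ) : List ℕ → List ℕ → Set where
  done : ∀ {ν} → Reduces k ν ν
  more : ∀ {ν μ κ} → RemoveStrip k ν μ → Reduces k μ κ → Reduces k ν κ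

IsKCore : ℕ → List ℕ → List ℕ → Set
IsKCore k ν κ = Reduces k ν κ × (∀ μ → ¬ RemoveStrip k κ μ)

-- Border strip tableaux: B : Cell → ℕ gives the label of each cell of λ

Strip : List ℕ → (Cell → ℕ) → ℕ → CellSet
Strip la B i x = InShape la x × B x ≡ i

-- B ∈ BST(λ,k) where m = n/k
IsBST : ℕ → ℕ → List ℕ → (Cell → ℕ) → Set
IsBST k m la B =
  (∀ x → InShape la x → 1 ≤ B x × B x ≤ m) ×
  (∀ r c → InShape la (r , suc c) → B (r , c) ≤ B (r , suc c)) ×
  (∀ r c → InShape la (suc r , c) → B (r , c) ≤ B (suc r , c)) ×
  (∀ i → 1 ≤ i → i ≤ m → IsBorderStrip (Strip la B i) k)

DesB : ℕ → List ℕ → (Cell → ℕ) → ℕ → Set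
DesB m la B i = 1 ≤ i × suc i ≤ m ×
  ∃ λ x → ∃ λ y → IsTail (Strip la B i) x × IsTail (Strip la B (suc i)) y × row x < row y

-- boundary word from bottom-left to top-right, rows given bottom-to-top
-- (true = east step 1, false = north step 0)
bword : ℕ → List ℕ → List Bool
bword p []       = []
bword p (r ∷ rs) = replicate (r ∸ p) true ++ (false ∷ bword r rs)

-- the letters at positions s, s+k, s+2k, ... (for s < k)
stride : ℕ → ℕ → List Bool → List Bool
stride k c []            = []
stride k zero (x ∷ xs)   = x ∷ stride k (k ∸ 1) xs
stride k (suc c) (x ∷ xs) = stride k c xs

-- rows (bottom-to-top, zero rows included) of the partition with a given word
wordRows : ℕ → List Bool → List ℕ
wordRows n []            = []
wordRows n (true ∷ w)    = wordRows (suc n) w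
wordRows n (false ∷ w)   = n ∷ wordRows n w

padRows : ℕ → List ℕ → List ℕ
padRows k μ = μ ++ replicate (k * length μ ∸ length μ) 0

boundaryWord : ℕ → List ℕ → List Bool
boundaryWord k μ = bword 0 (reverse (padRows k μ))

-- λ^s, the s-th component of the k-quotient (rows top-to-bottom; may
-- contain trailing zero rows, which do not affect the diagram)
quot : ℕ → List ℕ → ℕ → List ℕ
quot k μ s = reverse (wordRows 0 (stride k s (boundaryWord k μ)))

countᵇ : (ℕ → Bool) → ℕ → ℕ
countᵇ p zero    = 0
countᵇ p (suc n) = countᵇ p n + (if p n then 1 else 0)

-- ν_i : cells with labels ≤ i, as a list of row lengths
nuRows : (Cell → ℕ) → ℕ → ℕ → List ℕ → List ℕ
nuRows B i r []         = []
nuRows B i r (len ∷ ls) = countᵇ (λ c → B (r , c) ≤ᵇ i) len ∷ nuRows B i (suc r) ls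

nu : List ℕ → (Cell → ℕ) → ℕ → List ℕ
nu la B i = nuRows B i 0 la

-- least i in [j, j+f) with p i (j+f if none)
firstFrom : (ℕ → Bool) → ℕ → ℕ → ℕ
firstFrom p j zero    = j
firstFrom p j (suc f) = if p j then j else firstFrom p (suc j) f

-- label of cell x of the s-th diagram of the tuple 𝒯 corresponding to B:
-- the i with x ∈ (k-quotient of ν_i)^s \ (k-quotient of ν_{i-1})^s
lqLabel : ℕ → ℕ → List ℕ → (Cell → ℕ) → ℕ → Cell → ℕ
lqLabel k m la B s x = firstFrom (λ i → inShapeᵇ (quot k (nu la B i) s) x) 0 (suc m)

DesT : ℕ → ℕ → List ℕ → (Cell → ℕ) → ℕ → Set
DesT k m la B i = 1 ≤ i × suc i ≤ m ×
  ∃ λ s → ∃ λ t → ∃ λ a → ∃ λ b →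
    s < k × t < k ×
    InShape (quot k la s) a × lqLabel k m la B s a ≡ i ×
    InShape (quot k la t) b × lqLabel k m la B t b ≡ suc i ×
    ((s ≤ t × content b ℤ.< content a) ⊎ (t < s × content b ℤ.≤ content a))

module Submission where

-- Pad ν to N = k·ℓ(ν) rows and read its boundary as a word of north and east
-- steps; the north step of row r sits at the β-number νᵣ + N − 1 − r, and the
-- t-th diagram of the k-quotient is the word read along the runner t, t+k, t+2k, ….
-- Adding the border strip labelled i+1 to νᵢ, with bottom row b, replaces the
-- β-number p = νᵢ(b) + N − 1 − b by p + k.  On runner s = p mod k a bead moves
-- from q = p div k to q + 1, which adds a single cell to the s-th diagram, on the
-- diagonal q + 1 − ℓ(λ).  So both descent conditions say that p decreases from
-- strip i to strip i+1: for B because the tail of a strip lies in its bottom row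
-- and a lower bottom row means a smaller p, for 𝒯 because comparing contents and
-- diagram indices is comparing the pairs (q, s) lexicographically.  The first
-- strip starts at the corner, so p = N − 1 − b and p mod k = k − 1 − b, where b
-- is its height.

open import Defs
open import Data.Bool using (Bool; true; false)
open import Data.Bool.Properties using (T-≡)
open import Data.Empty using (⊥-elim)
open import Data.Integer as ℤ using (+≤+; +<+)
import Data.Integer.Properties as ℤP
import Data.Integer.Tactic.RingSolver as ℤRing
open import Data.List using (List; []; _∷_; length; reverse; replicate; _++_; _∷ʳ_; applyUpTo; upTo)
open import Data.List.Properties using (length-++; ++-assoc; length-replicate; length-reverse; unfold-reverse; reverse-++; length-applyUpTo; length-upTo)
open import Data.List.Membership.Propositional using (_∈_)
open import Data.List.Membership.Propositional.Properties using (∈-∃++; ∈-++⁻; ∈-++⁺ˡ; ∈-++⁺ʳ; ∈-applyUpTo⁺; ∈-applyUpTo⁻; ∈-upTo⁺; ∈-upTo⁻)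
import Data.List.Relation.Unary.All as All
open import Data.List.Relation.Unary.AllPairs using (_∷_)
open import Data.List.Relation.Unary.Any using (here; there)
open import Data.List.Relation.Unary.Linked using (Linked; []; [-]; _∷_)
open import Data.List.Relation.Unary.Unique.Propositional using (Unique)
open import Data.List.Relation.Unary.Unique.Propositional.Properties using (++⁺; applyUpTo⁺₁; upTo⁺)
open import Data.Nat
open import Data.Nat.Divisibility using (_∣_)
open import Data.Nat.DivMod using (m≡m%n+[m/n]*n; [m+kn]%n≡m%n; m<n⇒m%n≡m; m%n<n)
open import Data.Nat.ListAction using (sum)
open import Data.Nat.Properties
open import Data.Nat.Tactic.RingSolver using (solve-∀)
open import Data.Product as Product using (Σ; ∃; _×_; _,_; proj₁; proj₂)
open import Data.Sum as Sum using (_⊎_; inj₁; inj₂; [_,_]′)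
open import Function.Bundles using (_⇔_; mk⇔; Equivalence)
open import Relation.Binary.Definitions using (tri<; tri≈; tri>)
open import Relation.Binary.PropositionalEquality
open import Relation.Nullary using (¬_; Dec; yes; no)

applyUpTo-cong : ∀ {A : Set} {f g : ℕ → A} n → (∀ j → j < n → f j ≡ g j) → applyUpTo f n ≡ applyUpTo g n
applyUpTo-cong zero    f≗g = refl
applyUpTo-cong (suc n) f≗g = cong₂ _∷_ (f≗g 0 z<s) (applyUpTo-cong n (λ j j<n → f≗g (suc j) (s<s j<n)))

applyUpTo-+ : ∀ {A : Set} (f : ℕ → A) n m → applyUpTo f (n + m) ≡ applyUpTo f n ++ applyUpTo (λ j → f (n + j)) m
applyUpTo-+ f zero    m = refl
applyUpTo-+ f (suc n) m = cong (f 0 ∷_) (applyUpTo-+ (λ j → f (suc j)) n m)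

applyUpTo-replicate : ∀ {A : Set} {f : ℕ → A} {x} n → (∀ j → j < n → f j ≡ x) → applyUpTo f n ≡ replicate n x
applyUpTo-replicate zero    fx = refl
applyUpTo-replicate (suc n) fx = cong₂ _∷_ (fx 0 z<s) (applyUpTo-replicate n (λ j j<n → fx (suc j) (s<s j<n)))

reverse-replicate : ∀ {A : Set} n (x : A) → reverse (replicate n x) ≡ replicate n x
reverse-replicate zero    x = refl
reverse-replicate (suc n) x = begin
  reverse (x ∷ replicate n x)  ≡⟨ unfold-reverse x (replicate n x) ⟩
  reverse (replicate n x) ∷ʳ x ≡⟨ cong (_∷ʳ x) (reverse-replicate n x) ⟩
  replicate n x ∷ʳ x           ≡⟨ replicate-∷ʳ n ⟩
  x ∷ replicate n x            ∎
  where
  open ≡-Reasoning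
  replicate-∷ʳ : ∀ n → replicate n x ∷ʳ x ≡ x ∷ replicate n x
  replicate-∷ʳ zero    = refl
  replicate-∷ʳ (suc n) = cong (x ∷_) (replicate-∷ʳ n)

applyUpTo-around : ∀ {A : Set} (f : ℕ → A) q e →
  applyUpTo f (q + suc (suc e)) ≡ applyUpTo f q ++ f q ∷ f (suc q) ∷ applyUpTo (λ j → f (q + suc (suc j))) e
applyUpTo-around f q e = trans (applyUpTo-+ f q (suc (suc e)))
  (cong₂ (λ x y → applyUpTo f q ++ f x ∷ f y ∷ applyUpTo (λ j → f (q + suc (suc j))) e) (+-identityʳ q) (+-comm q 1))

Bool-≡-from-false : ∀ {x y : Bool} → (x ≡ false → y ≡ false) → (y ≡ false → x ≡ false) → x ≡ y
Bool-≡-from-false {true}  {true}  _ _ = refl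
Bool-≡-from-false {true}  {false} _ y⇒x = y⇒x refl
Bool-≡-from-false {false} {true}  x⇒y _ = sym (x⇒y refl)
Bool-≡-from-false {false} {false} _ _ = refl

rowLen-++ˡ : ∀ xs ys i → i < length xs → rowLen (xs ++ ys) i ≡ rowLen xs i
rowLen-++ˡ (x ∷ xs) ys zero    _         = refl
rowLen-++ˡ (x ∷ xs) ys (suc i) (s≤s i<n) = rowLen-++ˡ xs ys i i<n

rowLen-++ʳ : ∀ xs ys i → rowLen (xs ++ ys) (length xs + i) ≡ rowLen ys i
rowLen-++ʳ []       ys i = refl
rowLen-++ʳ (x ∷ xs) ys i = rowLen-++ʳ xs ys i

rowLen-replicate-0 : ∀ n i → rowLen (replicate n 0) i ≡ 0
rowLen-replicate-0 zero    i       = refl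
rowLen-replicate-0 (suc n) zero    = refl
rowLen-replicate-0 (suc n) (suc i) = rowLen-replicate-0 n i

rowLen-beyond : ∀ xs i → rowLen xs (length xs + i) ≡ 0
rowLen-beyond []       i = refl
rowLen-beyond (x ∷ xs) i = rowLen-beyond xs i

rowLen-mid : ∀ xs x ys → rowLen (xs ++ x ∷ ys) (length xs) ≡ x
rowLen-mid xs x ys = trans (cong (rowLen (xs ++ x ∷ ys)) (sym (+-identityʳ _))) (rowLen-++ʳ xs (x ∷ ys) 0)

rowLen-replaceMid : ∀ xs x y ys r → r ≢ length xs → rowLen (xs ++ x ∷ ys) r ≡ rowLen (xs ++ y ∷ ys) r
rowLen-replaceMid xs x y ys r r≢ with <-cmp r (length xs)
... | tri< r<n _ _ = trans (rowLen-++ˡ xs _ r r<n) (sym (rowLen-++ˡ xs _ r r<n))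
... | tri≈ _ r≡n _ = ⊥-elim (r≢ r≡n)
... | tri> _ _ r>n with m≤n⇒∃[o]m+o≡n r>n
...   | (o , refl) = begin
  rowLen (xs ++ x ∷ ys) (suc (length xs + o)) ≡⟨ cong (rowLen (xs ++ x ∷ ys)) (sym (+-suc (length xs) o)) ⟩
  rowLen (xs ++ x ∷ ys) (length xs + suc o)   ≡⟨ rowLen-++ʳ xs (x ∷ ys) (suc o) ⟩
  rowLen ys o                                 ≡⟨ sym (rowLen-++ʳ xs (y ∷ ys) (suc o)) ⟩
  rowLen (xs ++ y ∷ ys) (length xs + suc o)   ≡⟨ cong (rowLen (xs ++ y ∷ ys)) (+-suc (length xs) o) ⟩
  rowLen (xs ++ y ∷ ys) (suc (length xs + o)) ∎
  where open ≡-Reasoning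

rowLen-reverse : ∀ xs i j → i + suc j ≡ length xs → rowLen (reverse xs) i ≡ rowLen xs j
rowLen-reverse [] i j e with trans (sym (+-suc i j)) e
... | ()
rowLen-reverse (x ∷ xs) i zero e rewrite unfold-reverse x xs =
  trans (cong (rowLen (reverse xs ∷ʳ x)) i≡) (rowLen-++ʳ (reverse xs) (x ∷ []) 0)
  where
  i≡ : i ≡ length (reverse xs) + 0
  i≡ = trans (suc-injective (trans (+-comm 1 i) e)) (trans (sym (length-reverse xs)) (sym (+-identityʳ _)))
rowLen-reverse (x ∷ xs) i (suc j) e rewrite unfold-reverse x xs =
  trans (rowLen-++ˡ (reverse xs) (x ∷ []) i i<n) (rowLen-reverse xs i j e′)
  where
  e′ : i + suc j ≡ length xs
  e′ = suc-injective (trans (sym (+-suc i (suc j))) e)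
  i<n : i < length (reverse xs)
  i<n = subst (i <_) (sym (length-reverse xs)) (subst (i <_) e′ (m<m+n i z<s))

rowLen≤sum : ∀ xs r → rowLen xs r ≤ sum xs
rowLen≤sum []       r       = z≤n
rowLen≤sum (x ∷ xs) zero    = m≤m+n x (sum xs)
rowLen≤sum (x ∷ xs) (suc r) = ≤-trans (rowLen≤sum xs r) (m≤n+m (sum xs) x)

RowsDecreasing : List ℕ → Set
RowsDecreasing ν = ∀ r → rowLen ν (suc r) ≤ rowLen ν r

rowLen-antitone : ∀ ν → RowsDecreasing ν → ∀ {r r′} → r ≤ r′ → rowLen ν r′ ≤ rowLen ν r
rowLen-antitone ν dec {r} r≤r′ with m≤n⇒∃[o]m+o≡n r≤r′
... | (o , refl) = go o
  where
  go : ∀ o → rowLen ν (r + o) ≤ rowLen ν r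
  go zero    = ≤-reflexive (cong (rowLen ν) (+-identityʳ r))
  go (suc o) = ≤-trans (≤-reflexive (cong (rowLen ν) (+-suc r o))) (≤-trans (dec (r + o)) (go o))

partition⇒rowsDecreasing : ∀ {ls} → Linked (λ a b → b ≤ a) ls → RowsDecreasing ls
partition⇒rowsDecreasing []        r       = z≤n
partition⇒rowsDecreasing [-]       zero    = z≤n
partition⇒rowsDecreasing [-]       (suc r) = z≤n
partition⇒rowsDecreasing (le ∷ l) zero    = le
partition⇒rowsDecreasing (le ∷ l) (suc r) = partition⇒rowsDecreasing l r

rowLen-padRows : ∀ k ν r → rowLen (padRows k ν) r ≡ rowLen ν r
rowLen-padRows k ν r with r <? length ν
... | yes r<n = rowLen-++ˡ ν _ r r<n
... | no r≮n with m≤n⇒∃[o]m+o≡n (≮⇒≥ r≮n)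
...   | (o , refl) = trans (rowLen-++ʳ ν _ o) (trans (rowLen-replicate-0 (k * length ν ∸ length ν) o) (sym (rowLen-beyond ν o)))

length-padRows : ∀ k ν → 0 < k → length (padRows k ν) ≡ k * length ν
length-padRows (suc k) ν _ = begin
  length (ν ++ replicate (suc k * length ν ∸ length ν) 0)         ≡⟨ length-++ ν ⟩
  length ν + length (replicate (suc k * length ν ∸ length ν) 0) ≡⟨ cong (length ν +_) (length-replicate _) ⟩
  length ν + (suc k * length ν ∸ length ν)                      ≡⟨ m+[n∸m]≡n (m≤m+n (length ν) (k * length ν)) ⟩
  suc k * length ν                                               ∎
  where open ≡-Reasoning

Increasing : ℕ → List ℕ → Set
Increasing p xs = Linked _≤_ (p ∷ xs)

increasing-rowLen : ∀ p xs → (0 < length xs → p ≤ rowLen xs 0) →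
  (∀ i → suc i < length xs → rowLen xs i ≤ rowLen xs (suc i)) → Increasing p xs
increasing-rowLen p []       first next = [-]
increasing-rowLen p (x ∷ xs) first next =
  first z<s ∷ increasing-rowLen x xs (λ 0<n → next 0 (s<s 0<n)) (λ i i<n → next (suc i) (s<s i<n))

increasing-lowerBound : ∀ {p xs} → Increasing p xs → ∀ i → i < length xs → p ≤ rowLen xs i
increasing-lowerBound (p≤x ∷ inc) zero    _         = p≤x
increasing-lowerBound (p≤x ∷ inc) (suc i) (s<s i<n) = ≤-trans p≤x (increasing-lowerBound inc i i<n)

-- Boundary words and β-numbers

-- `bwordAt p rs j` is the j-th letter of `bword p rs` followed by infinitely
-- many east steps; `runAt d x xs` reads d east steps, a north step, then `bword x xs`.
bwordAt : ℕ → List ℕ → ℕ → Bool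
runAt : ℕ → ℕ → List ℕ → ℕ → Bool
bwordAt p []       j = true
bwordAt p (x ∷ xs) j = runAt (x ∸ p) x xs j
runAt zero    x xs zero    = false
runAt zero    x xs (suc j) = bwordAt x xs j
runAt (suc d) x xs zero    = true
runAt (suc d) x xs (suc j) = runAt d x xs j

runAt-applyUpTo : ∀ d x xs n →
  applyUpTo (runAt d x xs) (d + suc n) ≡ replicate d true ++ false ∷ applyUpTo (bwordAt x xs) n
runAt-applyUpTo zero    x xs n = refl
runAt-applyUpTo (suc d) x xs n = cong (true ∷_) (runAt-applyUpTo d x xs n)

bword-++-east : ∀ p rs t → bword p rs ++ replicate t true ≡ applyUpTo (bwordAt p rs) (length (bword p rs) + t)
bword-++-east p [] t = sym (applyUpTo-replicate t (λ _ _ → refl))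
bword-++-east p (x ∷ xs) t = begin
  (east ++ false ∷ bword x xs) ++ replicate t true
    ≡⟨ ++-assoc east _ _ ⟩
  east ++ false ∷ (bword x xs ++ replicate t true)
    ≡⟨ cong (λ w → east ++ false ∷ w) (bword-++-east x xs t) ⟩
  east ++ false ∷ applyUpTo (bwordAt x xs) (length (bword x xs) + t)
    ≡⟨ runAt-applyUpTo (x ∸ p) x xs _ ⟨
  applyUpTo (runAt (x ∸ p) x xs) ((x ∸ p) + suc (length (bword x xs) + t))
    ≡⟨ cong (applyUpTo (runAt (x ∸ p) x xs)) lengths ⟩
  applyUpTo (runAt (x ∸ p) x xs) (length (east ++ false ∷ bword x xs) + t)
    ∎
  where
  open ≡-Reasoning
  east = replicate (x ∸ p) true
  lengths : (x ∸ p) + suc (length (bword x xs) + t) ≡ length (east ++ false ∷ bword x xs) + t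
  lengths rewrite length-++ east {false ∷ bword x xs} | length-replicate (x ∸ p) {true} =
    sym (+-assoc (x ∸ p) (suc (length (bword x xs))) t)

runAt-false⁻ : ∀ d x xs j → runAt d x xs j ≡ false →
  j ≡ d ⊎ Σ ℕ λ j′ → j ≡ d + suc j′ × bwordAt x xs j′ ≡ false
runAt-false⁻ zero    x xs zero    _ = inj₁ refl
runAt-false⁻ zero    x xs (suc j) e = inj₂ (j , refl , e)
runAt-false⁻ (suc d) x xs (suc j) e with runAt-false⁻ d x xs j e
... | inj₁ j≡d            = inj₁ (cong suc j≡d)
... | inj₂ (j′ , j≡ , e′) = inj₂ (j′ , cong suc j≡ , e′)

runAt-false-north : ∀ d x xs → runAt d x xs d ≡ false
runAt-false-north zero    x xs = refl
runAt-false-north (suc d) x xs = runAt-false-north d x xs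

runAt-false-later : ∀ d x xs j → bwordAt x xs j ≡ false → runAt d x xs (d + suc j) ≡ false
runAt-false-later zero    x xs j e = e
runAt-false-later (suc d) x xs j e = runAt-false-later d x xs j e

bwordAt-false⁻ : ∀ {p xs} j → Increasing p xs → bwordAt p xs j ≡ false →
  Σ ℕ λ i → i < length xs × j + p ≡ rowLen xs i + i
bwordAt-false⁻ {p} {x ∷ xs} j (p≤x ∷ inc) e with runAt-false⁻ (x ∸ p) x xs j e
... | inj₁ refl = 0 , z<s , trans (m∸n+n≡m p≤x) (sym (+-identityʳ x))
... | inj₂ (j′ , refl , e′) with bwordAt-false⁻ j′ inc e′
...   | (i , i<n , j′≡) = suc i , s<s i<n , (begin
  ((x ∸ p) + suc j′) + p    ≡⟨ shuffle (x ∸ p) j′ p ⟩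
  suc j′ + ((x ∸ p) + p)    ≡⟨ cong (suc j′ +_) (m∸n+n≡m p≤x) ⟩
  suc (j′ + x)              ≡⟨ cong suc j′≡ ⟩
  suc (rowLen xs i + i)     ≡⟨ +-suc (rowLen xs i) i ⟨
  rowLen xs i + suc i       ∎)
  where
  open ≡-Reasoning
  shuffle : ∀ y j p → (y + suc j) + p ≡ suc j + (y + p)
  shuffle = solve-∀

bwordAt-false⁺ : ∀ {p xs} j → Increasing p xs → ∀ i → i < length xs → j + p ≡ rowLen xs i + i →
  bwordAt p xs j ≡ false
bwordAt-false⁺ {p} {x ∷ xs} j (p≤x ∷ inc) zero _ e =
  subst (λ j → runAt (x ∸ p) x xs j ≡ false) (sym j≡) (runAt-false-north (x ∸ p) x xs)
  where
  j≡ : j ≡ x ∸ p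
  j≡ = +-cancelʳ-≡ p j (x ∸ p) (trans e (trans (+-identityʳ x) (sym (m∸n+n≡m p≤x))))
bwordAt-false⁺ {p} {x ∷ xs} j (p≤x ∷ inc) (suc i) (s<s i<n) e =
  subst (λ j → runAt (x ∸ p) x xs j ≡ false) (sym j≡) (runAt-false-later (x ∸ p) x xs j′ e′)
  where
  open ≡-Reasoning
  r = rowLen xs i
  x≤r+i : x ≤ r + i
  x≤r+i = ≤-trans (increasing-lowerBound inc i i<n) (m≤m+n r i)
  j′ = (r + i) ∸ x
  j′+x : j′ + x ≡ r + i
  j′+x = m∸n+n≡m x≤r+i
  e′ : bwordAt x xs j′ ≡ false
  e′ = bwordAt-false⁺ j′ inc i i<n j′+x
  j≡ : j ≡ (x ∸ p) + suc j′
  j≡ = +-cancelʳ-≡ p j ((x ∸ p) + suc j′) (begin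
    j + p                    ≡⟨ e ⟩
    r + suc i                ≡⟨ +-suc r i ⟩
    suc (r + i)              ≡⟨ cong suc j′+x ⟨
    suc (j′ + x)             ≡⟨ cong (suc j′ +_) (m∸n+n≡m p≤x) ⟨
    suc j′ + ((x ∸ p) + p)   ≡⟨ shuffle (x ∸ p) j′ p ⟨
    ((x ∸ p) + suc j′) + p   ∎)
    where
    shuffle : ∀ y j p → (y + suc j) + p ≡ suc j + (y + p)
    shuffle = solve-∀

length-bword : ∀ {p xs} X → Increasing p xs → (∀ i → i < length xs → rowLen xs i ≤ X) → p ≤ X →
  length (bword p xs) + p ≤ X + length xs
length-bword {p} {[]}     X _           _     p≤X = ≤-trans p≤X (≤-reflexive (sym (+-identityʳ X)))
length-bword {p} {x ∷ xs} X (p≤x ∷ inc) bound p≤X = begin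
  length (replicate (x ∸ p) true ++ false ∷ bword x xs) + p
    ≡⟨ cong (_+ p) (trans (length-++ (replicate (x ∸ p) true)) (cong (_+ suc (length (bword x xs))) (length-replicate (x ∸ p)))) ⟩
  ((x ∸ p) + suc (length (bword x xs))) + p
    ≡⟨ shuffle (x ∸ p) (length (bword x xs)) p ⟩
  suc (length (bword x xs) + ((x ∸ p) + p))
    ≡⟨ cong (λ y → suc (length (bword x xs) + y)) (m∸n+n≡m p≤x) ⟩
  suc (length (bword x xs) + x)
    ≤⟨ s≤s (length-bword X inc (λ i i<n → bound (suc i) (s<s i<n)) (bound 0 z<s)) ⟩
  suc (X + length xs)
    ≡⟨ +-suc X (length xs) ⟨
  X + length (x ∷ xs) ∎
  where
  open ≤-Reasoning
  shuffle : ∀ a b c → (a + suc b) + c ≡ suc (b + (a + c))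
  shuffle = solve-∀

-- j is the position of the north step of row r of the boundary word of ν
-- padded to N rows (rows are counted from the top).
IsBeta : ℕ → List ℕ → ℕ → Set
IsBeta N ν j = Σ ℕ λ r → r < N × j + suc r ≡ rowLen ν r + N

boundaryAt : ℕ → List ℕ → ℕ → Bool
boundaryAt k ν = bwordAt 0 (reverse (padRows k ν))

module _ (k : ℕ) (k>0 : 0 < k) (ν : List ℕ) (dec : RowsDecreasing ν) where

  private
    N = k * length ν
    rs = reverse (padRows k ν)

    length-rs : length rs ≡ N
    length-rs = trans (length-reverse (padRows k ν)) (length-padRows k ν k>0)

    rowLen-rs : ∀ i j → i + suc j ≡ N → rowLen rs i ≡ rowLen ν j
    rowLen-rs i j e = trans (rowLen-reverse (padRows k ν) i j (trans e (sym (length-padRows k ν k>0))))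
                            (rowLen-padRows k ν j)

    complement : ∀ i → i < N → Σ ℕ λ j → i + suc j ≡ N
    complement i i<N with m≤n⇒∃[o]m+o≡n i<N
    ... | (o , e) = o , trans (+-suc i o) e

    increasing-rs : Increasing 0 rs
    increasing-rs = increasing-rowLen 0 rs (λ _ → z≤n) next
      where
      next : ∀ i → suc i < length rs → rowLen rs i ≤ rowLen rs (suc i)
      next i i<n with complement (suc i) (subst (suc i <_) length-rs i<n)
      ... | (j , e) = subst₂ _≤_ (sym (rowLen-rs i (suc j) (trans (+-suc i (suc j)) e)))
                                 (sym (rowLen-rs (suc i) j e)) (dec j)

  boundaryAt-false⁻ : ∀ j → boundaryAt k ν j ≡ false → IsBeta N ν j
  boundaryAt-false⁻ j e with bwordAt-false⁻ j increasing-rs e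
  ... | (i , i<n , e′) with complement i (subst (i <_) length-rs i<n)
  ...   | (r , i+r) = r , r<N , (begin
    j + suc r                ≡⟨ cong (_+ suc r) (trans (sym (+-identityʳ j)) e′) ⟩
    (rowLen rs i + i) + suc r ≡⟨ +-assoc (rowLen rs i) i (suc r) ⟩
    rowLen rs i + (i + suc r) ≡⟨ cong₂ _+_ (rowLen-rs i r i+r) i+r ⟩
    rowLen ν r + N            ∎)
    where
    open ≡-Reasoning
    r<N : r < N
    r<N = subst (r <_) i+r (m≤n+m (suc r) i)

  boundaryAt-false⁺ : ∀ j → IsBeta N ν j → boundaryAt k ν j ≡ false
  boundaryAt-false⁺ j (r , r<N , e) with complement r r<N
  ... | (i , r+i) = bwordAt-false⁺ j increasing-rs i i<n e′
    where
    open ≡-Reasoning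
    i+r : i + suc r ≡ N
    i+r = trans (+-suc i r) (trans (cong suc (+-comm i r)) (trans (sym (+-suc r i)) r+i))
    i<n : i < length rs
    i<n = subst (i <_) (sym length-rs) (subst (i <_) i+r (m<m+n i z<s))
    e′ : j + 0 ≡ rowLen rs i + i
    e′ = +-cancelʳ-≡ (suc r) (j + 0) (rowLen rs i + i) (begin
      (j + 0) + suc r           ≡⟨ cong (_+ suc r) (+-identityʳ j) ⟩
      j + suc r                 ≡⟨ e ⟩
      rowLen ν r + N            ≡⟨ cong₂ _+_ (rowLen-rs i r i+r) i+r ⟨
      rowLen rs i + (i + suc r) ≡⟨ +-assoc (rowLen rs i) i (suc r) ⟨
      (rowLen rs i + i) + suc r ∎)

  boundaryWord-++-east : ∀ M → length (boundaryWord k ν) ≤ M →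
    boundaryWord k ν ++ replicate (M ∸ length (boundaryWord k ν)) true ≡ applyUpTo (boundaryAt k ν) M
  boundaryWord-++-east M le =
    trans (bword-++-east 0 rs (M ∸ length (boundaryWord k ν))) (cong (applyUpTo (boundaryAt k ν)) (m+[n∸m]≡n le))

  length-boundaryWord : ∀ X → (∀ r → rowLen ν r ≤ X) → length (boundaryWord k ν) ≤ X + N
  length-boundaryWord X bound = subst₂ _≤_ (+-identityʳ _) (cong (X +_) length-rs)
    (length-bword X increasing-rs bound-rs z≤n)
    where
    bound-rs : ∀ i → i < length rs → rowLen rs i ≤ X
    bound-rs i i<n with complement i (subst (i <_) length-rs i<n)
    ... | (j , e) = subst (_≤ X) (sym (rowLen-rs i j e)) (bound j)

-- Runners of the abacus

stride-++-skip : ∀ k (u : List Bool) c w → stride k (length u + c) (u ++ w) ≡ stride k c w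
stride-++-skip k []      c w = refl
stride-++-skip k (x ∷ u) c w = stride-++-skip k u c w

stride-++ : ∀ k c (xs ys : List Bool) → Σ ℕ λ c′ → stride k c (xs ++ ys) ≡ stride k c xs ++ stride k c′ ys
stride-++ k c       []       ys = c , refl
stride-++ k zero    (x ∷ xs) ys with stride-++ k (k ∸ 1) xs ys
... | (c′ , e) = c′ , cong (x ∷_) e
stride-++ k (suc c) (x ∷ xs) ys = stride-++ k c xs ys

stride-replicate : ∀ k c t (b : Bool) → Σ ℕ λ t′ → stride k c (replicate t b) ≡ replicate t′ b
stride-replicate k c       zero    b = 0 , refl
stride-replicate k zero    (suc t) b with stride-replicate k (k ∸ 1) t b
... | (t′ , e) = suc t′ , cong (b ∷_) e
stride-replicate k (suc c) (suc t) b = stride-replicate k c t b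

stride-applyUpTo-block : ∀ k s f w → s < k → stride k s (applyUpTo f k ++ w) ≡ f s ∷ stride k s w
stride-applyUpTo-block k s f w s<k with m≤n⇒∃[o]m+o≡n s<k
... | (e , refl) = begin
  stride k s (applyUpTo f (suc s + e) ++ w)
    ≡⟨ cong (λ u → stride k s (u ++ w)) (trans (cong (applyUpTo f) (sym (+-suc s e))) (applyUpTo-+ f s (suc e))) ⟩
  stride k s ((before ++ f (s + 0) ∷ after) ++ w)
    ≡⟨ cong (stride k s) (++-assoc before _ w) ⟩
  stride k s (before ++ f (s + 0) ∷ after ++ w)
    ≡⟨ cong (λ c → stride k c (before ++ f (s + 0) ∷ after ++ w)) (trans (sym (+-identityʳ s)) (cong (_+ 0) (sym (length-applyUpTo f s)))) ⟩
  stride k (length before + 0) (before ++ f (s + 0) ∷ after ++ w)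
    ≡⟨ stride-++-skip k before 0 _ ⟩
  f (s + 0) ∷ stride k (s + e) (after ++ w)
    ≡⟨ cong₂ _∷_ (cong f (+-identityʳ s)) (cong (λ c → stride k c (after ++ w)) (trans (+-comm s e) (cong (_+ s) (sym (length-applyUpTo _ e))))) ⟩
  f s ∷ stride k (length after + s) (after ++ w)
    ≡⟨ cong (f s ∷_) (stride-++-skip k after s w) ⟩
  f s ∷ stride k s w ∎
  where
  open ≡-Reasoning
  before = applyUpTo f s
  after = applyUpTo (λ j → f (s + suc j)) e

stride-applyUpTo : ∀ k s f Q → s < k → stride k s (applyUpTo f (k * Q)) ≡ applyUpTo (λ j → f (s + k * j)) Q
stride-applyUpTo k s f zero    s<k rewrite *-zeroʳ k = refl
stride-applyUpTo k s f (suc Q) s<k = begin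
  stride k s (applyUpTo f (k * suc Q))
    ≡⟨ cong (λ n → stride k s (applyUpTo f n)) (*-suc k Q) ⟩
  stride k s (applyUpTo f (k + k * Q))
    ≡⟨ cong (stride k s) (applyUpTo-+ f k (k * Q)) ⟩
  stride k s (applyUpTo f k ++ applyUpTo (λ j → f (k + j)) (k * Q))
    ≡⟨ stride-applyUpTo-block k s f _ s<k ⟩
  f s ∷ stride k s (applyUpTo (λ j → f (k + j)) (k * Q))
    ≡⟨ cong (f s ∷_) (stride-applyUpTo k s (λ j → f (k + j)) Q s<k) ⟩
  f s ∷ applyUpTo (λ j → f (k + (s + k * j))) Q
    ≡⟨ cong₂ _∷_ (cong f (sym (trans (cong (s +_) (*-zeroʳ k)) (+-identityʳ s))))
                 (applyUpTo-cong Q (λ j _ → cong f (shuffle k s j))) ⟩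
  applyUpTo (λ j → f (s + k * j)) (suc Q) ∎
  where
  open ≡-Reasoning
  shuffle : ∀ k s j → k + (s + k * j) ≡ s + k * suc j
  shuffle = solve-∀

wordRows-east : ∀ n t → wordRows n (replicate t true) ≡ []
wordRows-east n zero    = refl
wordRows-east n (suc t) = wordRows-east (suc n) t

wordRows-++-east : ∀ n w t → wordRows n (w ++ replicate t true) ≡ wordRows n w
wordRows-++-east n []          t = wordRows-east n t
wordRows-++-east n (true ∷ w)  t = wordRows-++-east (suc n) w t
wordRows-++-east n (false ∷ w) t = cong (n ∷_) (wordRows-++-east n w t)

shapeOfWord : List Bool → List ℕ
shapeOfWord w = reverse (wordRows 0 w)

runner : ℕ → List ℕ → ℕ → ℕ → Bool
runner k ν s j = boundaryAt k ν (s + k * j)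

quot-runner : ∀ k ν s Q → s < k → 0 < k → RowsDecreasing ν → length (boundaryWord k ν) ≤ k * Q →
  quot k ν s ≡ shapeOfWord (applyUpTo (runner k ν s) Q)
quot-runner k ν s Q s<k k>0 dec short = cong reverse (begin
  wordRows 0 (stride k s bw)                            ≡⟨ wordRows-++-east 0 (stride k s bw) t′ ⟨
  wordRows 0 (stride k s bw ++ replicate t′ true)       ≡⟨ cong (λ u → wordRows 0 (stride k s bw ++ u)) et′ ⟨
  wordRows 0 (stride k s bw ++ stride k c′ east)        ≡⟨ cong (wordRows 0) ec′ ⟨
  wordRows 0 (stride k s (bw ++ east))                  ≡⟨ cong (λ u → wordRows 0 (stride k s u)) (boundaryWord-++-east k k>0 ν dec (k * Q) short) ⟩
  wordRows 0 (stride k s (applyUpTo (boundaryAt k ν) (k * Q))) ≡⟨ cong (wordRows 0) (stride-applyUpTo k s (boundaryAt k ν) Q s<k) ⟩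
  wordRows 0 (applyUpTo (runner k ν s) Q)               ∎)
  where
  open ≡-Reasoning
  bw = boundaryWord k ν
  east = replicate (k * Q ∸ length bw) true
  c′ = proj₁ (stride-++ k s bw east)
  ec′ = proj₂ (stride-++ k s bw east)
  t′ = proj₁ (stride-replicate k c′ (k * Q ∸ length bw) true)
  et′ = proj₂ (stride-replicate k c′ (k * Q ∸ length bw) true)

-- Moving a bead: swapping a north and an east step adds one cell

eastSteps northSteps : List Bool → ℕ
eastSteps []          = 0
eastSteps (true ∷ w)  = suc (eastSteps w)
eastSteps (false ∷ w) = eastSteps w
northSteps []          = 0
northSteps (true ∷ w)  = northSteps w
northSteps (false ∷ w) = suc (northSteps w)

eastSteps+northSteps : ∀ w → eastSteps w + northSteps w ≡ length w
eastSteps+northSteps []          = refl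
eastSteps+northSteps (true ∷ w)  = cong suc (eastSteps+northSteps w)
eastSteps+northSteps (false ∷ w) = trans (+-suc (eastSteps w) (northSteps w)) (cong suc (eastSteps+northSteps w))

northSteps-++ : ∀ u w → northSteps (u ++ w) ≡ northSteps u + northSteps w
northSteps-++ []          w = refl
northSteps-++ (true ∷ u)  w = northSteps-++ u w
northSteps-++ (false ∷ u) w = cong suc (northSteps-++ u w)

northSteps-east : ∀ n → northSteps (replicate n true) ≡ 0
northSteps-east zero    = refl
northSteps-east (suc n) = northSteps-east n

northSteps-north : ∀ n → northSteps (replicate n false) ≡ n
northSteps-north zero    = refl
northSteps-north (suc n) = cong suc (northSteps-north n)

wordRows-++ : ∀ n u w → wordRows n (u ++ w) ≡ wordRows n u ++ wordRows (n + eastSteps u) w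
wordRows-++ n []          w = cong (λ m → wordRows m w) (sym (+-identityʳ n))
wordRows-++ n (true ∷ u)  w = trans (wordRows-++ (suc n) u w) (cong (λ m → wordRows (suc n) u ++ wordRows m w) (sym (+-suc n (eastSteps u))))
wordRows-++ n (false ∷ u) w = cong (n ∷_) (wordRows-++ n u w)

length-wordRows : ∀ n w → length (wordRows n w) ≡ northSteps w
length-wordRows n []          = refl
length-wordRows n (true ∷ w)  = length-wordRows (suc n) w
length-wordRows n (false ∷ w) = cong suc (length-wordRows n w)

wordRows-north : ∀ n → wordRows 0 (replicate n false) ≡ replicate n 0
wordRows-north zero    = refl
wordRows-north (suc n) = cong (0 ∷_) (wordRows-north n)

module SwapNorthEast (U Z : List Bool) where

  private
    old = U ++ false ∷ true ∷ Z
    new = U ++ true ∷ false ∷ Z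
    below = reverse (wordRows (suc (eastSteps U)) Z)
    above = reverse (wordRows 0 U)

  cellRow cellCol : ℕ
  cellRow = northSteps Z
  cellCol = eastSteps U

  private
    length-below : length below ≡ cellRow
    length-below = trans (length-reverse (wordRows (suc cellCol) Z)) (length-wordRows (suc cellCol) Z)

    shape-around : ∀ mid c → wordRows cellCol mid ≡ c ∷ wordRows (suc cellCol) Z →
      shapeOfWord (U ++ mid) ≡ below ++ c ∷ above
    shape-around mid c e = begin
      reverse (wordRows 0 (U ++ mid))                            ≡⟨ cong reverse (wordRows-++ 0 U mid) ⟩
      reverse (wordRows 0 U ++ wordRows cellCol mid)             ≡⟨ cong (λ w → reverse (wordRows 0 U ++ w)) e ⟩
      reverse (wordRows 0 U ++ c ∷ wordRows (suc cellCol) Z)     ≡⟨ reverse-++ (wordRows 0 U) _ ⟩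
      reverse (c ∷ wordRows (suc cellCol) Z) ++ above            ≡⟨ cong (_++ above) (unfold-reverse c (wordRows (suc cellCol) Z)) ⟩
      (below ∷ʳ c) ++ above                                      ≡⟨ ++-assoc below (c ∷ []) above ⟩
      below ++ c ∷ above                                         ∎
      where open ≡-Reasoning

    shape-old : shapeOfWord old ≡ below ++ cellCol ∷ above
    shape-old = shape-around (false ∷ true ∷ Z) cellCol refl

    shape-new : shapeOfWord new ≡ below ++ suc cellCol ∷ above
    shape-new = shape-around (true ∷ false ∷ Z) (suc cellCol) refl

    rowLen-old-cellRow : rowLen (shapeOfWord old) cellRow ≡ cellCol
    rowLen-old-cellRow = trans (cong₂ rowLen shape-old (sym length-below)) (rowLen-mid below cellCol above)

    rowLen-new-cellRow : rowLen (shapeOfWord new) cellRow ≡ suc cellCol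
    rowLen-new-cellRow = trans (cong₂ rowLen shape-new (sym length-below)) (rowLen-mid below (suc cellCol) above)

    rowLen-other : ∀ r → r ≢ cellRow → rowLen (shapeOfWord new) r ≡ rowLen (shapeOfWord old) r
    rowLen-other r r≢ = begin
      rowLen (shapeOfWord new) r            ≡⟨ cong (λ ρ → rowLen ρ r) shape-new ⟩
      rowLen (below ++ suc cellCol ∷ above) r ≡⟨ rowLen-replaceMid below _ _ above r (λ e → r≢ (trans e length-below)) ⟩
      rowLen (below ++ cellCol ∷ above) r     ≡⟨ cong (λ ρ → rowLen ρ r) shape-old ⟨
      rowLen (shapeOfWord old) r            ∎
      where open ≡-Reasoning

  swap-shape⁻ : ∀ x → InShape (shapeOfWord new) x → InShape (shapeOfWord old) x ⊎ x ≡ (cellRow , cellCol)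
  swap-shape⁻ (r , c) inNew with r ≟ cellRow
  ... | no r≢ = inj₁ (subst (c <_) (rowLen-other r r≢) inNew)
  ... | yes refl with c ≟ cellCol
  ...   | yes refl = inj₂ refl
  ...   | no c≢ = inj₁ (subst (c <_) (sym rowLen-old-cellRow)
                         (≤∧≢⇒< (≤-pred (subst (c <_) rowLen-new-cellRow inNew)) c≢))

  swap-shape⁺ : ∀ x → InShape (shapeOfWord old) x ⊎ x ≡ (cellRow , cellCol) → InShape (shapeOfWord new) x
  swap-shape⁺ (r , c) (inj₂ refl) = subst (cellCol <_) (sym rowLen-new-cellRow) (n<1+n cellCol)
  swap-shape⁺ (r , c) (inj₁ inOld) with r ≟ cellRow
  ... | yes refl = subst (c <_) (sym rowLen-new-cellRow) (m<n⇒m<1+n (subst (c <_) rowLen-old-cellRow inOld))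
  ... | no r≢ = subst (c <_) (sym (rowLen-other r r≢)) inOld

  swap-cell-fresh : ¬ InShape (shapeOfWord old) (cellRow , cellCol)
  swap-cell-fresh inOld = <-irrefl refl (subst (cellCol <_) rowLen-old-cellRow inOld)

  northSteps-swap : northSteps new ≡ northSteps old
  northSteps-swap = trans (northSteps-++ U (true ∷ false ∷ Z)) (sym (northSteps-++ U (false ∷ true ∷ Z)))

  -- The diagonal of the new cell is read off from its position in the word.
  swap-cell-diagonal : cellCol + northSteps old ≡ suc (length U + cellRow)
  swap-cell-diagonal = begin
    cellCol + northSteps old                          ≡⟨ cong (cellCol +_) (northSteps-++ U (false ∷ true ∷ Z)) ⟩
    cellCol + (northSteps U + suc cellRow)            ≡⟨ +-assoc cellCol (northSteps U) (suc cellRow) ⟨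
    (cellCol + northSteps U) + suc cellRow            ≡⟨ cong (_+ suc cellRow) (eastSteps+northSteps U) ⟩
    length U + suc cellRow                            ≡⟨ +-suc (length U) cellRow ⟩
    suc (length U + cellRow)                          ∎
    where open ≡-Reasoning

-- Border strips

Unique-length-≤ : ∀ {A : Set} (xs ys : List A) → Unique xs → (∀ z → z ∈ xs → z ∈ ys) → length xs ≤ length ys
Unique-length-≤ []       ys u         xs⊆ys = z≤n
Unique-length-≤ (x ∷ xs) ys (x∉ ∷ u) xs⊆ys with ∈-∃++ (xs⊆ys x (here refl))
... | (ys₁ , ys₂ , refl) = begin
  suc (length xs)                ≤⟨ s≤s (Unique-length-≤ xs (ys₁ ++ ys₂) u xs⊆ys₁₂) ⟩
  suc (length (ys₁ ++ ys₂))      ≡⟨ cong suc (length-++ ys₁) ⟩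
  suc (length ys₁ + length ys₂)  ≡⟨ +-suc (length ys₁) (length ys₂) ⟨
  length ys₁ + length (x ∷ ys₂)  ≡⟨ length-++ ys₁ ⟨
  length (ys₁ ++ x ∷ ys₂)        ∎
  where
  open ≤-Reasoning
  xs⊆ys₁₂ : ∀ z → z ∈ xs → z ∈ ys₁ ++ ys₂
  xs⊆ys₁₂ z z∈xs with ∈-++⁻ ys₁ (xs⊆ys z (there z∈xs))
  ... | inj₁ z∈ys₁         = ∈-++⁺ˡ z∈ys₁
  ... | inj₂ (here refl)   = ⊥-elim (All.lookup x∉ z∈xs refl)
  ... | inj₂ (there z∈ys₂) = ∈-++⁺ʳ ys₁ z∈ys₂

Unique-length-≡ : ∀ {A : Set} (xs ys : List A) → Unique xs → Unique ys →
  (∀ z → z ∈ xs → z ∈ ys) → (∀ z → z ∈ ys → z ∈ xs) → length xs ≡ length ys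
Unique-length-≡ xs ys uxs uys xs⊆ys ys⊆xs = ≤-antisym (Unique-length-≤ xs ys uxs xs⊆ys) (Unique-length-≤ ys xs uys ys⊆xs)

least-witness : (P : ℕ → Set) → (∀ n → Dec (P n)) → ∀ n → P n → Σ ℕ λ a → P a × (∀ r → r < a → ¬ P r)
least-witness P P? n Pn = search 0 n refl (λ r ())
  where
  search : ∀ i fuel → i + fuel ≡ n → (∀ r → r < i → ¬ P r) → Σ ℕ λ a → P a × (∀ r → r < a → ¬ P r)
  search i zero    e none = i , subst P (sym (trans (sym (+-identityʳ i)) e)) Pn , none
  search i (suc f) e none with P? i
  ... | yes Pi = i , Pi , none
  ... | no ¬Pi = search (suc i) f (trans (sym (+-suc i f)) e) none′
    where
    none′ : ∀ r → r < suc i → ¬ P r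
    none′ r r<1+i with m≤n⇒m<n∨m≡n (≤-pred r<1+i)
    ... | inj₁ r<i  = none r r<i
    ... | inj₂ refl = ¬Pi

greatest-witness : (P : ℕ → Set) → (∀ n → Dec (P n)) → ∀ n L → P n → (∀ r → P r → r < L) →
  Σ ℕ λ b → P b × (∀ r → b < r → ¬ P r)
greatest-witness P P? n L Pn bounded = search L (λ r L≤r Pr → <-irrefl refl (≤-<-trans L≤r (bounded r Pr)))
  where
  search : ∀ m → (∀ r → m ≤ r → ¬ P r) → Σ ℕ λ b → P b × (∀ r → b < r → ¬ P r)
  search zero    none = ⊥-elim (none n z≤n Pn)
  search (suc m) none with P? m
  ... | yes Pm = m , Pm , none
  ... | no ¬Pm = search m none′
    where
    none′ : ∀ r → m ≤ r → ¬ P r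
    none′ r m≤r with m≤n⇒m<n∨m≡n m≤r
    ... | inj₁ m<r  = none r m<r
    ... | inj₂ refl = ¬Pm

path-crossing : ∀ {S : CellSet} {x y} → Path S x y → S x → ∀ r → row x ≤ r → r < row y →
  Σ ℕ λ c → S (r , c) × S (suc r , c)
path-crossing here Sx r x≤r r<x = ⊥-elim (<-irrefl refl (≤-<-trans x≤r r<x))
path-crossing (step (inj₁ (refl , _)) Sz p) Sx r x≤r r<y = path-crossing p Sz r x≤r r<y
path-crossing (step (inj₂ (inj₁ (refl , _))) Sz p) Sx r x≤r r<y = path-crossing p Sz r x≤r r<y
path-crossing {S} {x} (step (inj₂ (inj₂ (inj₁ (refl , refl)))) Sz p) Sx r x≤r r<y with m≤n⇒m<n∨m≡n x≤r
... | inj₁ x<r  = path-crossing p Sz r x<r r<y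
... | inj₂ refl = col x , Sx , Sz
path-crossing (step (inj₂ (inj₂ (inj₂ (refl , refl)))) Sz p) Sx r x≤r r<y =
  path-crossing p Sz r (≤-trans (n≤1+n _) x≤r) r<y

-- A border strip ν/μ of size k occupies the rows a … b, in which each row
-- starts just below the end of the previous one; counting its cells row by
-- row gives the size relation.
record StripRows (k : ℕ) (μ ν : ℕ → ℕ) (L : ℕ) (S : CellSet) : Set where
  field
    a b        : ℕ
    a≤b        : a ≤ b
    b<L        : b < L
    above-a    : ∀ r → r < a → ν r ≡ μ r
    below-b    : ∀ r → b < r → ν r ≡ μ r
    staircase  : ∀ r → a ≤ r → r < b → ν (suc r) ≡ suc (μ r)
    μa<νa      : μ a < ν a
    μb<νb      : μ b < ν b
    size       : k + μ b + a ≡ ν a + b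
    rows       : ∀ r c → S (r , c) → a ≤ r × r ≤ b

module _ (k : ℕ) (k>0 : 0 < k) (μ ν : ℕ → ℕ) (L : ℕ)
  (decμ : ∀ r → μ (suc r) ≤ μ r) (decν : ∀ r → ν (suc r) ≤ ν r)
  (μ≤ν : ∀ r → μ r ≤ ν r) (ν-beyond : ∀ r → L ≤ r → ν r ≡ 0)
  (S : CellSet) (S⁻ : ∀ r c → S (r , c) → c < ν r × μ r ≤ c)
  (S⁺ : ∀ r c → c < ν r → μ r ≤ c → S (r , c))
  (strip : IsBorderStrip S k) where

  private
    connected = proj₁ (proj₂ strip)
    no2x2 = proj₁ (proj₂ (proj₂ strip))
    sized = proj₂ (proj₂ (proj₂ strip))

    Occupied : ℕ → Set
    Occupied r = μ r < ν r

    unoccupied : ∀ r → ¬ Occupied r → ν r ≡ μ r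
    unoccupied r ¬occ = ≤-antisym (≮⇒≥ ¬occ) (μ≤ν r)

    occupied<L : ∀ r → Occupied r → r < L
    occupied<L r occ with r <? L
    ... | yes r<L = r<L
    ... | no r≮L = ⊥-elim (n≮0 (subst (μ r <_) (ν-beyond r (≮⇒≥ r≮L)) occ))

    someCell : Σ Cell S
    someCell with sized
    ... | ([]     , _ , _   , len≡k) = ⊥-elim (<-irrefl len≡k k>0)
    ... | (x ∷ xs , _ , mem , _)     = x , Equivalence.to (mem x) (here refl)

    occupied-someCell : Occupied (row (proj₁ someCell))
    occupied-someCell = let (c<ν , μ≤c) = S⁻ _ _ (proj₂ someCell) in ≤-<-trans μ≤c c<ν

    top = least-witness Occupied (λ r → μ r <? ν r) _ occupied-someCell
    bottom = greatest-witness Occupied (λ r → μ r <? ν r) _ L occupied-someCell occupied<L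

    a b : ℕ
    a = proj₁ top
    b = proj₁ bottom

    μa<νa : μ a < ν a
    μa<νa = proj₁ (proj₂ top)

    μb<νb : μ b < ν b
    μb<νb = proj₁ (proj₂ bottom)

    a≤b : a ≤ b
    a≤b = ≮⇒≥ (λ b<a → proj₂ (proj₂ bottom) a b<a μa<νa)

    rows : ∀ r c → S (r , c) → a ≤ r × r ≤ b
    rows r c Src = let (c<ν , μ≤c) = S⁻ r c Src ; occ = ≤-<-trans μ≤c c<ν in
      ≮⇒≥ (λ r<a → proj₂ (proj₂ top) r r<a occ) , ≮⇒≥ (λ b<r → proj₂ (proj₂ bottom) r b<r occ)

    staircase : ∀ r → a ≤ r → r < b → ν (suc r) ≡ suc (μ r)
    staircase r a≤r r<b with path-crossing (connected _ _ Sa Sb) Sa r a≤r r<b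
      where
      Sa = S⁺ a (μ a) μa<νa ≤-refl
      Sb = S⁺ b (μ b) μb<νb ≤-refl
    ... | (c , Src , Sr+1c) = ≤-antisym no-square (≤-<-trans (proj₂ (S⁻ r c Src)) (proj₁ (S⁻ (suc r) c Sr+1c)))
      where
      no-square : ν (suc r) ≤ suc (μ r)
      no-square = ≮⇒≥ (λ big → no2x2 r (μ r)
        ( S⁺ r (μ r) (<-≤-trans (<-trans (n<1+n _) big) (decν r)) ≤-refl
        , S⁺ r (suc (μ r)) (<-≤-trans big (decν r)) (n≤1+n _)
        , S⁺ (suc r) (μ r) (<-trans (n<1+n _) big) (decμ r)
        , S⁺ (suc r) (suc (μ r)) big (≤-trans (decμ r) (n≤1+n _))))

    rowCells : ℕ → List Cell
    rowCells r = applyUpTo (λ c → (r , μ r + c)) (ν r ∸ μ r)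

    rowsFrom : ℕ → ℕ → List Cell
    rowsFrom r zero    = rowCells r
    rowsFrom r (suc d) = rowCells r ++ rowsFrom (suc r) d

    rowCells⁻ : ∀ r z → z ∈ rowCells r → row z ≡ r × μ r ≤ col z × col z < ν r
    rowCells⁻ r z z∈ with ∈-applyUpTo⁻ _ z∈
    ... | (i , i<n , refl) = refl , m≤m+n (μ r) i , subst (μ r + i <_) (m+[n∸m]≡n (μ≤ν r)) (+-monoʳ-< (μ r) i<n)

    rowCells⁺ : ∀ r c → μ r ≤ c → c < ν r → (r , c) ∈ rowCells r
    rowCells⁺ r c μ≤c c<ν with m≤n⇒∃[o]m+o≡n μ≤c
    ... | (o , refl) = ∈-applyUpTo⁺ (λ c → (r , μ r + c)) {o}
      (+-cancelˡ-< (μ r) o (ν r ∸ μ r) (subst (μ r + o <_) (sym (m+[n∸m]≡n (μ≤ν r))) c<ν))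

    rowsFrom⁻ : ∀ r d z → z ∈ rowsFrom r d → r ≤ row z × row z ≤ r + d × μ (row z) ≤ col z × col z < ν (row z)
    rowsFrom⁻ r zero z z∈ with rowCells⁻ r z z∈
    ... | (refl , μ≤ , <ν) = ≤-refl , m≤m+n _ 0 , μ≤ , <ν
    rowsFrom⁻ r (suc d) z z∈ with ∈-++⁻ (rowCells r) z∈
    ... | inj₁ z∈r with rowCells⁻ r z z∈r
    ...   | (refl , μ≤ , <ν) = ≤-refl , m≤m+n _ _ , μ≤ , <ν
    rowsFrom⁻ r (suc d) z z∈ | inj₂ z∈rest with rowsFrom⁻ (suc r) d z z∈rest
    ...   | (r< , ≤r+d , μ≤ , <ν) = <⇒≤ r< , subst (row z ≤_) (sym (+-suc r d)) ≤r+d , μ≤ , <ν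

    rowsFrom⁺ : ∀ r d r′ c → r ≤ r′ → r′ ≤ r + d → μ r′ ≤ c → c < ν r′ → (r′ , c) ∈ rowsFrom r d
    rowsFrom⁺ r zero r′ c r≤r′ r′≤ μ≤ <ν with ≤-antisym r≤r′ (subst (r′ ≤_) (+-identityʳ r) r′≤)
    ... | refl = rowCells⁺ r c μ≤ <ν
    rowsFrom⁺ r (suc d) r′ c r≤r′ r′≤ μ≤ <ν with m≤n⇒m<n∨m≡n r≤r′
    ... | inj₂ refl = ∈-++⁺ˡ (rowCells⁺ r c μ≤ <ν)
    ... | inj₁ r<r′ = ∈-++⁺ʳ (rowCells r) (rowsFrom⁺ (suc r) d r′ c r<r′ (subst (r′ ≤_) (+-suc r d) r′≤) μ≤ <ν)

    unique-rowsFrom : ∀ r d → Unique (rowsFrom r d)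
    unique-rowsFrom r zero    = applyUpTo⁺₁ _ _ (λ i<j _ e → <-irrefl (+-cancelˡ-≡ _ _ _ (cong proj₂ e)) i<j)
    unique-rowsFrom r (suc d) = ++⁺ (unique-rowsFrom r zero) (unique-rowsFrom (suc r) d)
      (λ { {z} (z∈r , z∈rest) → <-irrefl (sym (proj₁ (rowCells⁻ r z z∈r))) (proj₁ (rowsFrom⁻ (suc r) d z z∈rest)) })

    a+d≡b : a + (b ∸ a) ≡ b
    a+d≡b = m+[n∸m]≡n a≤b

    rowsFrom-a⇔S : ∀ z → z ∈ rowsFrom a (b ∸ a) ⇔ S z
    rowsFrom-a⇔S (r , c) = mk⇔
      (λ z∈ → let (_ , _ , μ≤ , <ν) = rowsFrom⁻ a (b ∸ a) (r , c) z∈ in S⁺ r c <ν μ≤)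
      (λ Src → let (a≤r , r≤b) = rows r c Src ; (<ν , μ≤) = S⁻ r c Src in
        rowsFrom⁺ a (b ∸ a) r c a≤r (subst (r ≤_) (sym a+d≡b) r≤b) μ≤ <ν)

    length-rowsFrom-a : length (rowsFrom a (b ∸ a)) ≡ k
    length-rowsFrom-a = trans
      (Unique-length-≡ (rowsFrom a (b ∸ a)) xs (unique-rowsFrom a (b ∸ a)) uxs
        (λ z z∈ → Equivalence.from (mem z) (Equivalence.to (rowsFrom-a⇔S z) z∈))
        (λ z z∈ → Equivalence.from (rowsFrom-a⇔S z) (Equivalence.to (mem z) z∈)))
      len≡k
      where
      xs = proj₁ sized
      uxs = proj₁ (proj₂ sized)
      mem = proj₁ (proj₂ (proj₂ sized))
      len≡k = proj₂ (proj₂ (proj₂ sized))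

    length-rowCells : ∀ r → length (rowCells r) + μ r ≡ ν r
    length-rowCells r = trans (cong (_+ μ r) (length-applyUpTo _ (ν r ∸ μ r))) (m∸n+n≡m (μ≤ν r))

    telescope : ∀ d r → r + d ≡ b → a ≤ r → length (rowsFrom r d) + μ b + r ≡ ν r + b
    telescope zero r r≡b a≤r rewrite sym (trans (sym (+-identityʳ r)) r≡b) = cong (_+ r) (length-rowCells r)
    telescope (suc d) r r+d≡b a≤r = +-cancelʳ-≡ 1 _ _ (begin
      (length (rowCells r ++ rowsFrom (suc r) d) + μ b + r) + 1
        ≡⟨ cong (λ n → (n + μ b + r) + 1) (length-++ (rowCells r)) ⟩
      ((length (rowCells r) + length (rowsFrom (suc r) d)) + μ b + r) + 1
        ≡⟨ shuffle (length (rowCells r)) (length (rowsFrom (suc r) d)) (μ b) r ⟩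
      length (rowCells r) + (length (rowsFrom (suc r) d) + μ b + suc r)
        ≡⟨ cong (length (rowCells r) +_) (telescope d (suc r) (trans (sym (+-suc r d)) r+d≡b) (≤-trans a≤r (n≤1+n r))) ⟩
      length (rowCells r) + (ν (suc r) + b)
        ≡⟨ cong (λ n → length (rowCells r) + (n + b)) (staircase r a≤r r<b) ⟩
      length (rowCells r) + (suc (μ r) + b)
        ≡⟨ shuffle′ (length (rowCells r)) (μ r) b ⟩
      (length (rowCells r) + μ r) + b + 1
        ≡⟨ cong (λ n → n + b + 1) (length-rowCells r) ⟩
      (ν r + b) + 1 ∎)
      where
      open ≡-Reasoning
      r<b : r < b
      r<b = subst (r <_) r+d≡b (m<m+n r z<s)
      shuffle : ∀ x y u r → ((x + y) + u + r) + 1 ≡ x + (y + u + suc r)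
      shuffle = solve-∀
      shuffle′ : ∀ x m b → x + (suc m + b) ≡ (x + m) + b + 1
      shuffle′ = solve-∀

  stripRows : StripRows k μ ν L S
  stripRows = record
    { a = a ; b = b ; a≤b = a≤b ; b<L = occupied<L b μb<νb
    ; above-a = λ r r<a → unoccupied r (proj₂ (proj₂ top) r r<a)
    ; below-b = λ r b<r → unoccupied r (proj₂ (proj₂ bottom) r b<r)
    ; staircase = staircase ; μa<νa = μa<νa ; μb<νb = μb<νb
    ; size = trans (cong (λ n → n + μ b + a) (sym length-rowsFrom-a)) (telescope (b ∸ a) a a+d≡b ≤-refl)
    ; rows = rows }

-- The north step of a lower row sits strictly earlier in the word.

northStep-<ʳ : ∀ {N j j′ u v X Y} → j + suc u ≡ X + N → j′ + suc v ≡ Y + N → u < v → Y ≤ X → j′ < j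
northStep-<ʳ {N} {j} {j′} {u} {v} {X} {Y} ej ej′ u<v Y≤X = +-cancelʳ-< (suc u) j′ j (begin-strict
  j′ + suc u <⟨ +-monoʳ-< j′ (s≤s u<v) ⟩
  j′ + suc v ≡⟨ ej′ ⟩
  Y + N      ≤⟨ +-monoˡ-≤ N Y≤X ⟩
  X + N      ≡⟨ ej ⟨
  j + suc u  ∎)
  where open ≤-Reasoning

northStep-<ˡ : ∀ {N j j′ u v X Y} → j + suc u ≡ X + N → j′ + suc v ≡ Y + N → u ≤ v → Y < X → j′ < j
northStep-<ˡ {N} {j} {j′} {u} {v} {X} {Y} ej ej′ u≤v Y<X = +-cancelʳ-< (suc u) j′ j (begin-strict
  j′ + suc u ≤⟨ +-monoʳ-≤ j′ (s≤s u≤v) ⟩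
  j′ + suc v ≡⟨ ej′ ⟩
  Y + N      <⟨ +-monoˡ-< N Y<X ⟩
  X + N      ≡⟨ ej ⟨
  j + suc u  ∎)
  where open ≤-Reasoning
divMod-unique : ∀ {k t s j q} .{{_ : NonZero k}} → t < k → s < k → t + k * j ≡ s + k * q → t ≡ s × j ≡ q
divMod-unique {k} {t} {s} {j} {q} t<k s<k e =
  t≡s , *-cancelˡ-≡ j q k (+-cancelˡ-≡ s _ _ (subst (λ x → x + k * j ≡ s + k * q) t≡s e))
  where
  open ≡-Reasoning
  remainder : ∀ {x y} → x < k → (x + k * y) % k ≡ x
  remainder {x} {y} x<k = begin
    (x + k * y) % k ≡⟨ cong (λ z → (x + z) % k) (*-comm k y) ⟩
    (x + y * k) % k ≡⟨ [m+kn]%n≡m%n x y k ⟩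
    x % k           ≡⟨ m<n⇒m%n≡m x<k ⟩
    x               ∎
  t≡s : t ≡ s
  t≡s = trans (sym (remainder t<k)) (trans (cong (_% k) e) (remainder s<k))

remainder-of-complement : ∀ {k L b s q} .{{_ : NonZero k}} → b < k → b < L → s < k →
  (s + k * q) + suc b ≡ k * L → s ≡ k ∸ 1 ∸ b
remainder-of-complement {suc k′} {suc L′} {b} {s} {q} (s≤s b≤k′) _ s<k e =
  sym (proj₁ (divMod-unique (s≤s (m∸n≤m k′ b)) s<k (+-cancelʳ-≡ (suc b) _ _ (begin
    ((k′ ∸ b) + suc k′ * L′) + suc b  ≡⟨ shuffle (k′ ∸ b) k′ L′ b ⟩
    suc (((k′ ∸ b) + b) + suc k′ * L′) ≡⟨ cong (λ x → suc (x + suc k′ * L′)) (m∸n+n≡m b≤k′) ⟩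
    suc (k′ + suc k′ * L′)            ≡⟨ *-suc (suc k′) L′ ⟨
    suc k′ * suc L′                   ≡⟨ e ⟨
    (s + suc k′ * q) + suc b          ∎))))
  where
  open ≡-Reasoning
  shuffle : ∀ x k′ L′ b → (x + suc k′ * L′) + suc b ≡ suc ((x + b) + suc k′ * L′)
  shuffle = solve-∀

firstFrom⁻ : ∀ p j f r → firstFrom p j f ≡ r → (∀ r′ → j ≤ r′ → r′ < r → p r′ ≡ false) × (r < j + f → p r ≡ true)
firstFrom⁻ p j zero r refl = (λ r′ j≤r′ r′<j → ⊥-elim (<-irrefl refl (<-≤-trans r′<j j≤r′))) , (λ j<j+0 → ⊥-elim (<-irrefl (sym (+-identityʳ j)) j<j+0))
firstFrom⁻ p j (suc f) r e with p j in pj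
... | true = (λ r′ j≤r′ r′<r → ⊥-elim (<-irrefl refl (<-≤-trans (subst (r′ <_) (sym e) r′<r) j≤r′))) , (λ _ → subst (λ x → p x ≡ true) e pj)
... | false with firstFrom⁻ p (suc j) f r e
...   | (before , at) = before′ , (λ r<j+1+f → at (subst (r <_) (+-suc j f) r<j+1+f))
  where
  before′ : ∀ r′ → j ≤ r′ → r′ < r → p r′ ≡ false
  before′ r′ j≤r′ r′<r with m≤n⇒m<n∨m≡n j≤r′
  ... | inj₁ j<r′ = before r′ j<r′ r′<r
  ... | inj₂ refl = pj

firstFrom⁺ : ∀ p j f r → j ≤ r → r < j + f → p r ≡ true → (∀ r′ → j ≤ r′ → r′ < r → p r′ ≡ false) → firstFrom p j f ≡ r
firstFrom⁺ p j zero r j≤r r<j+0 _ _ = ⊥-elim (<-irrefl refl (<-≤-trans (subst (r <_) (+-identityʳ j) r<j+0) j≤r))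
firstFrom⁺ p j (suc f) r j≤r r<j+f pr before with p j in pj | m≤n⇒m<n∨m≡n j≤r
... | true  | inj₂ j≡r = j≡r
... | true  | inj₁ j<r with trans (sym pj) (before j ≤-refl j<r)
...   | ()
firstFrom⁺ p j (suc f) r j≤r r<j+f pr before | false | inj₂ refl with trans (sym pj) pr
...   | ()
firstFrom⁺ p j (suc f) r j≤r r<j+f pr before | false | inj₁ j<r =
  firstFrom⁺ p (suc j) f r j<r (subst (r <_) (+-suc j f) r<j+f) pr (λ r′ j<r′ → before r′ (<⇒≤ j<r′))

module _ (p : ℕ → Bool) (m : ℕ) (mono : ∀ i j → i ≤ j → j ≤ m → p i ≡ true → p j ≡ true) where

  firstFrom-switch⁻ : ∀ i → suc i ≤ m → firstFrom p 0 (suc m) ≡ suc i → p (suc i) ≡ true × p i ≡ false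
  firstFrom-switch⁻ i i<m e = let (before , at) = firstFrom⁻ p 0 (suc m) (suc i) e in
    at (s≤s i<m) , before i z≤n (n<1+n i)

  firstFrom-switch⁺ : ∀ i → suc i ≤ m → p (suc i) ≡ true → p i ≡ false → firstFrom p 0 (suc m) ≡ suc i
  firstFrom-switch⁺ i i<m on off = firstFrom⁺ p 0 (suc m) (suc i) z≤n (s≤s i<m) on before
    where
    before : ∀ r → 0 ≤ r → r < suc i → p r ≡ false
    before r _ r<1+i with p r in pr
    ... | false = refl
    ... | true with trans (sym (mono r i (≤-pred r<1+i) (≤-trans (n≤1+n i) i<m) pr)) off
    ...   | ()

position-<-quotient : ∀ {k s t q q′} → t < k → q′ < q → t + k * q′ < s + k * q
position-<-quotient {k} {s} {t} {q} {q′} t<k q′<q = begin-strict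
  t + k * q′   <⟨ +-monoˡ-< (k * q′) t<k ⟩
  k + k * q′   ≡⟨ *-suc k q′ ⟨
  k * suc q′   ≤⟨ *-monoʳ-≤ k q′<q ⟩
  k * q        ≤⟨ m≤n+m (k * q) s ⟩
  s + k * q    ∎
  where open ≤-Reasoning

lexicographic-<⁺ : ∀ {k s t q q′} → t < k → (s ≤ t × q′ < q) ⊎ (t < s × q′ ≤ q) → t + k * q′ < s + k * q
lexicographic-<⁺ t<k (inj₁ (_ , q′<q))      = position-<-quotient t<k q′<q
lexicographic-<⁺ {k} _ (inj₂ (t<s , q′≤q)) = +-mono-<-≤ t<s (*-monoʳ-≤ k q′≤q)

lexicographic-<⁻ : ∀ {k s t q q′} → s < k → t + k * q′ < s + k * q → (s ≤ t × q′ < q) ⊎ (t < s × q′ ≤ q)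
lexicographic-<⁻ {k} {s} {t} {q} {q′} s<k lt with <-cmp q′ q | s ≤? t
... | tri< q′<q _ _ | yes s≤t = inj₁ (s≤t , q′<q)
... | tri< q′<q _ _ | no s≰t  = inj₂ (≰⇒> s≰t , <⇒≤ q′<q)
... | tri≈ _ refl _ | _       = inj₂ (+-cancelʳ-< (k * q′) t s lt , ≤-refl)
... | tri> _ _ q<q′ | _       = ⊥-elim (<-asym lt (position-<-quotient s<k q<q′))

module _ where

  open ℤ using (+_)

  private
    content-shift : ∀ r c r′ → content (r , c) ℤ.+ + (r + r′) ≡ + (c + r′)
    content-shift r c r′ = begin
      (+ c ℤ.- + r) ℤ.+ + (r + r′)      ≡⟨ cong (λ x → (+ c ℤ.- + r) ℤ.+ x) (ℤP.pos-+ r r′) ⟩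
      (+ c ℤ.- + r) ℤ.+ (+ r ℤ.+ + r′)  ≡⟨ cancel (+ c) (+ r) (+ r′) ⟩
      + c ℤ.+ + r′                      ≡⟨ ℤP.pos-+ c r′ ⟨
      + (c + r′)                        ∎
      where
      open ≡-Reasoning
      cancel : ∀ (C R R′ : ℤ.ℤ) → (C ℤ.- R) ℤ.+ (R ℤ.+ R′) ≡ C ℤ.+ R′
      cancel = ℤRing.solve-∀

    content-unshift : ∀ r c r′ → + (c + r′) ℤ.- + (r + r′) ≡ content (r , c)
    content-unshift r c r′ = begin
      + (c + r′) ℤ.- + (r + r′)         ≡⟨ cong₂ (λ x y → x ℤ.- y) (ℤP.pos-+ c r′) (ℤP.pos-+ r r′) ⟩
      (+ c ℤ.+ + r′) ℤ.- (+ r ℤ.+ + r′) ≡⟨ cancel (+ c) (+ r) (+ r′) ⟩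
      + c ℤ.- + r                       ∎
      where
      open ≡-Reasoning
      cancel : ∀ (C R R′ : ℤ.ℤ) → (C ℤ.+ R′) ℤ.- (R ℤ.+ R′) ≡ C ℤ.- R
      cancel = ℤRing.solve-∀

    content-shift′ : ∀ r c r′ → content (r′ , c) ℤ.+ + (r + r′) ≡ + (c + r)
    content-shift′ r c r′ = trans (cong (λ n → content (r′ , c) ℤ.+ + n) (+-comm r r′)) (content-shift r′ c r)

    content-unshift′ : ∀ r c r′ → + (c + r) ℤ.- + (r + r′) ≡ content (r′ , c)
    content-unshift′ r c r′ = trans (cong (λ n → + (c + r) ℤ.- + n) (+-comm r r′)) (content-unshift r′ c r)

  content-≤⁻ : ∀ r c r′ c′ → content (r , c) ℤ.≤ content (r′ , c′) → c + r′ ≤ c′ + r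
  content-≤⁻ r c r′ c′ le = ℤP.drop‿+≤+ (subst₂ ℤ._≤_ (content-shift r c r′) (content-shift′ r c′ r′)
    (ℤP.+-monoˡ-≤ (+ (r + r′)) le))

  content-≤⁺ : ∀ r c r′ c′ → c + r′ ≤ c′ + r → content (r , c) ℤ.≤ content (r′ , c′)
  content-≤⁺ r c r′ c′ le = subst₂ ℤ._≤_ (content-unshift r c r′) (content-unshift′ r c′ r′)
    (ℤP.+-monoˡ-≤ (ℤ.- + (r + r′)) (+≤+ le))

  content-<⁻ : ∀ r c r′ c′ → content (r , c) ℤ.< content (r′ , c′) → c + r′ < c′ + r
  content-<⁻ r c r′ c′ lt = ℤP.drop‿+<+ (subst₂ ℤ._<_ (content-shift r c r′) (content-shift′ r c′ r′)
    (ℤP.+-monoˡ-< (+ (r + r′)) lt))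

  content-<⁺ : ∀ r c r′ c′ → c + r′ < c′ + r → content (r , c) ℤ.< content (r′ , c′)
  content-<⁺ r c r′ c′ lt = subst₂ ℤ._<_ (content-unshift r c r′) (content-unshift′ r c′ r′)
    (ℤP.+-monoˡ-< (ℤ.- + (r + r′)) (+<+ lt))

module _ {L n R q n′ R′ q′ : ℕ} (diag : n + L ≡ suc (q + R)) (diag′ : n′ + L ≡ suc (q′ + R′)) where

  private
    shift : (n + R′) + L ≡ suc (q + (R + R′))
    shift = begin
      (n + R′) + L       ≡⟨ swap n R′ L ⟩
      (n + L) + R′       ≡⟨ cong (_+ R′) diag ⟩
      suc (q + R) + R′   ≡⟨ cong suc (+-assoc q R R′) ⟩
      suc (q + (R + R′)) ∎
      where
      open ≡-Reasoning
      swap : ∀ a b c → (a + b) + c ≡ (a + c) + b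
      swap = solve-∀

    shift′ : (n′ + R) + L ≡ suc (q′ + (R + R′))
    shift′ = begin
      (n′ + R) + L        ≡⟨ swap n′ R L ⟩
      (n′ + L) + R        ≡⟨ cong (_+ R) diag′ ⟩
      suc (q′ + R′) + R   ≡⟨ cong suc (swap′ q′ R′ R) ⟩
      suc (q′ + (R + R′)) ∎
      where
      open ≡-Reasoning
      swap : ∀ a b c → (a + b) + c ≡ (a + c) + b
      swap = solve-∀
      swap′ : ∀ a b c → (a + b) + c ≡ a + (c + b)
      swap′ = solve-∀

  content-diagonal-< : content (R′ , n′) ℤ.< content (R , n) ⇔ q′ < q
  content-diagonal-< = mk⇔
    (λ lt → +-cancelʳ-< (R + R′) q′ q (≤-pred (subst₂ _<_ shift′ shift (+-monoˡ-< L (content-<⁻ R′ n′ R n lt)))))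
    (λ q′<q → content-<⁺ R′ n′ R n (+-cancelʳ-< L _ _ (subst₂ _<_ (sym shift′) (sym shift) (s≤s (+-monoˡ-< (R + R′) q′<q)))))

  content-diagonal-≤ : content (R′ , n′) ℤ.≤ content (R , n) ⇔ q′ ≤ q
  content-diagonal-≤ = mk⇔
    (λ le → +-cancelʳ-≤ (R + R′) q′ q (≤-pred (subst₂ _≤_ shift′ shift (+-monoˡ-≤ L (content-≤⁻ R′ n′ R n le)))))
    (λ q′≤q → content-≤⁺ R′ n′ R n (+-cancelʳ-≤ L _ _ (subst₂ _≤_ (sym shift′) (sym shift) (s≤s (+-monoˡ-≤ (R + R′) q′≤q)))))

-- The flag ν₀ ⊆ ν₁ ⊆ … ⊆ νₘ of a border strip tableau

-- Row r of νᵢ counts the cells of row r labelled ≤ i, and these form a prefix of the row.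
PrefixClosed : (ℕ → Bool) → ℕ → Set
PrefixClosed p n = ∀ c → suc c < n → p (suc c) ≡ true → p c ≡ true

module _ {p : ℕ → Bool} where

  countᵇ-≤ : ∀ n → countᵇ p n ≤ n
  countᵇ-≤ zero = z≤n
  countᵇ-≤ (suc n) with p n
  ... | true  = subst (_≤ suc n) (+-comm 1 (countᵇ p n)) (s≤s (countᵇ-≤ n))
  ... | false = subst (_≤ suc n) (sym (+-identityʳ _)) (m≤n⇒m≤1+n (countᵇ-≤ n))

  countᵇ-all : ∀ n → (∀ c → c < n → p c ≡ true) → countᵇ p n ≡ n
  countᵇ-all zero    all = refl
  countᵇ-all (suc n) all rewrite all n ≤-refl =
    trans (cong (_+ 1) (countᵇ-all n (λ c c<n → all c (m<n⇒m<1+n c<n)))) (+-comm n 1)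

  prefixClosed-below : ∀ {n} → PrefixClosed p n → ∀ c d → c + d < n → p (c + d) ≡ true → p c ≡ true
  prefixClosed-below closed c zero    _  pc+d = subst (λ x → p x ≡ true) (+-identityʳ c) pc+d
  prefixClosed-below {n} closed c (suc d) lt pc+d =
    prefixClosed-below closed c d (<-trans (n<1+n _) lt′) (closed (c + d) lt′ (subst (λ x → p x ≡ true) (+-suc c d) pc+d))
    where
    lt′ : suc (c + d) < n
    lt′ = subst (_< n) (+-suc c d) lt

  prefixClosed-shrink : ∀ {n} → PrefixClosed p (suc n) → PrefixClosed p n
  prefixClosed-shrink closed c c<n = closed c (m<n⇒m<1+n c<n)

  prefixClosed-last : ∀ {n} → PrefixClosed p (suc n) → p n ≡ true → ∀ c → c < suc n → p c ≡ true
  prefixClosed-last {n} closed pn c c<1+n with m≤n⇒∃[o]m+o≡n (≤-pred c<1+n)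
  ... | (o , refl) = prefixClosed-below closed c o ≤-refl pn

  countᵇ-prefix⁻ : ∀ n → PrefixClosed p n → ∀ c → c < countᵇ p n → c < n × p c ≡ true
  countᵇ-prefix⁻ (suc n) closed c c<count with p n in pn
  ... | true  = c<1+n , prefixClosed-last closed pn c c<1+n
    where c<1+n = ≤-trans c<count (subst (_≤ suc n) (+-comm 1 _) (s≤s (countᵇ-≤ n)))
  ... | false =
    let (c<n , pc) = countᵇ-prefix⁻ n (prefixClosed-shrink closed) c (subst (c <_) (+-identityʳ _) c<count)
    in m<n⇒m<1+n c<n , pc

  countᵇ-prefix⁺ : ∀ n → PrefixClosed p n → ∀ c → c < n → p c ≡ true → c < countᵇ p n
  countᵇ-prefix⁺ (suc n) closed c c<1+n pc with p n in pn
  ... | true  = subst (c <_) (trans (cong suc (sym (countᵇ-all n (λ c′ c′<n → prefixClosed-last closed pn c′ (m<n⇒m<1+n c′<n))))) (+-comm 1 _)) c<1+n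
  ... | false with m≤n⇒m<n∨m≡n (≤-pred c<1+n)
  ...   | inj₁ c<n  = subst (c <_) (sym (+-identityʳ _)) (countᵇ-prefix⁺ n (prefixClosed-shrink closed) c c<n pc)
  ...   | inj₂ refl with trans (sym pc) pn
  ...     | ()

module Tableau (k : ℕ) .{{_ : NonZero k}} (la : List ℕ) (B : Cell → ℕ) (m : ℕ)
  (partition : IsPartition la) (bst : IsBST k m la B) where

  private
    k>0 = >-nonZero⁻¹ k
    labels-range = proj₁ bst
    rows-weak = proj₁ (proj₂ bst)
    cols-weak = proj₁ (proj₂ (proj₂ bst))
    strips = proj₂ (proj₂ (proj₂ bst))

  ν : ℕ → ℕ → ℕ
  ν i r = rowLen (nu la B i) r

  L N : ℕ
  L = length la
  N = k * L

  L≤N : L ≤ N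
  L≤N = m≤n*m L k

  private
    nuRows-rowLen : ∀ i r₀ ls r → rowLen (nuRows B i r₀ ls) r ≡ countᵇ (λ c → B (r₀ + r , c) ≤ᵇ i) (rowLen ls r)
    nuRows-rowLen i r₀ []       r       = refl
    nuRows-rowLen i r₀ (x ∷ ls) zero    = cong (λ r′ → countᵇ (λ c → B (r′ , c) ≤ᵇ i) x) (sym (+-identityʳ r₀))
    nuRows-rowLen i r₀ (x ∷ ls) (suc r) = trans (nuRows-rowLen i (suc r₀) ls r)
      (cong (λ r′ → countᵇ (λ c → B (r′ , c) ≤ᵇ i) (rowLen ls r)) (sym (+-suc r₀ r)))

    ≤ᵇ-true⁻ : ∀ {a b} → (a ≤ᵇ b) ≡ true → a ≤ b
    ≤ᵇ-true⁻ {a} {b} e = ≤ᵇ⇒≤ a b (Equivalence.from T-≡ e)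

    ≤ᵇ-true⁺ : ∀ {a b} → a ≤ b → (a ≤ᵇ b) ≡ true
    ≤ᵇ-true⁺ a≤b = Equivalence.to T-≡ (≤⇒≤ᵇ a≤b)

    labels-prefixClosed : ∀ i r → PrefixClosed (λ c → B (r , c) ≤ᵇ i) (rowLen la r)
    labels-prefixClosed i r c c<n e = ≤ᵇ-true⁺ (≤-trans (rows-weak r c c<n) (≤ᵇ-true⁻ e))

    rowLen≤ : ∀ x y → (∀ c → c < x → c < y) → x ≤ y
    rowLen≤ zero    y below = z≤n
    rowLen≤ (suc x) y below = below x ≤-refl

  nu⁻ : ∀ i r c → c < ν i r → c < rowLen la r × B (r , c) ≤ i
  nu⁻ i r c c<ν =
    let (c<n , e) = countᵇ-prefix⁻ (rowLen la r) (labels-prefixClosed i r) c (subst (c <_) (nuRows-rowLen i 0 la r) c<ν)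
    in c<n , ≤ᵇ-true⁻ e

  nu⁺ : ∀ i r c → c < rowLen la r → B (r , c) ≤ i → c < ν i r
  nu⁺ i r c c<n Bc≤i = subst (c <_) (sym (nuRows-rowLen i 0 la r))
    (countᵇ-prefix⁺ (rowLen la r) (labels-prefixClosed i r) c c<n (≤ᵇ-true⁺ Bc≤i))

  nu-≤ : ∀ i r → ν i r ≤ rowLen la r
  nu-≤ i r = rowLen≤ _ _ (λ c c<ν → proj₁ (nu⁻ i r c c<ν))

  nu-decreasing : ∀ i → RowsDecreasing (nu la B i)
  nu-decreasing i r = rowLen≤ _ _ (λ c c<ν → let (c<n , B≤i) = nu⁻ i (suc r) c c<ν in
    nu⁺ i r c (<-≤-trans c<n (partition⇒rowsDecreasing (proj₁ partition) r)) (≤-trans (cols-weak r c c<n) B≤i))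

  nu-mono : ∀ {i j} → i ≤ j → ∀ r → ν i r ≤ ν j r
  nu-mono i≤j r = rowLen≤ _ _ (λ c c<ν → let (c<n , B≤i) = nu⁻ _ r c c<ν in nu⁺ _ r c c<n (≤-trans B≤i i≤j))

  nu-empty : ∀ r → ν 0 r ≡ 0
  nu-empty r = n≤0⇒n≡0 (rowLen≤ _ 0 (λ c c<ν → let (c<n , B≤0) = nu⁻ 0 r c c<ν in
    ⊥-elim (<-irrefl refl (≤-trans (proj₁ (labels-range (r , c) c<n)) B≤0))))

  nu-full : nu la B m ≡ la
  nu-full = all-labelled 0 la (λ r c c<n → proj₂ (labels-range (r , c) c<n))
    where
    all-labelled : ∀ r₀ ls → (∀ r c → c < rowLen ls r → B (r₀ + r , c) ≤ m) → nuRows B m r₀ ls ≡ ls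
    all-labelled r₀ []       _ = refl
    all-labelled r₀ (x ∷ ls) labelled = cong₂ _∷_
      (countᵇ-all x (λ c c<x → ≤ᵇ-true⁺ (subst (λ r → B (r , c) ≤ m) (+-identityʳ r₀) (labelled 0 c c<x))))
      (all-labelled (suc r₀) ls (λ r c c<n → subst (λ r′ → B (r′ , c) ≤ m) (+-suc r₀ r) (labelled (suc r) c c<n)))

  length-nu : ∀ i → length (nu la B i) ≡ L
  length-nu i = go 0 la
    where
    go : ∀ r₀ ls → length (nuRows B i r₀ ls) ≡ length ls
    go r₀ []       = refl
    go r₀ (x ∷ ls) = cong suc (go (suc r₀) ls)

  nu-beyond : ∀ i r → L ≤ r → ν i r ≡ 0
  nu-beyond i r L≤r with m≤n⇒∃[o]m+o≡n L≤r
  ... | (o , refl) = n≤0⇒n≡0 (≤-trans (nu-≤ i (L + o)) (≤-reflexive (rowLen-beyond la o)))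

  strip⁻ : ∀ i r c → Strip la B (suc i) (r , c) → c < ν (suc i) r × ν i r ≤ c
  strip⁻ i r c (c<n , Bc≡) = nu⁺ (suc i) r c c<n (≤-reflexive Bc≡) ,
    ≮⇒≥ (λ c<ν → <-irrefl Bc≡ (s≤s (proj₂ (nu⁻ i r c c<ν))))

  strip⁺ : ∀ i r c → c < ν (suc i) r → ν i r ≤ c → Strip la B (suc i) (r , c)
  strip⁺ i r c c<ν ν≤c = let (c<n , B≤) = nu⁻ (suc i) r c c<ν in
    c<n , ≤-antisym B≤ (≰⇒> (λ B≤i → <-irrefl refl (<-≤-trans (nu⁺ i r c c<n B≤i) ν≤c)))

  beta-false⁻ : ∀ i j → boundaryAt k (nu la B i) j ≡ false → IsBeta N (nu la B i) j
  beta-false⁻ i j e = subst (λ n → IsBeta (k * n) (nu la B i) j) (length-nu i)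
    (boundaryAt-false⁻ k k>0 (nu la B i) (nu-decreasing i) j e)

  beta-false⁺ : ∀ i j → IsBeta N (nu la B i) j → boundaryAt k (nu la B i) j ≡ false
  beta-false⁺ i j β = boundaryAt-false⁺ k k>0 (nu la B i) (nu-decreasing i) j
    (subst (λ n → IsBeta (k * n) (nu la B i) j) (sym (length-nu i)) β)

  beta-true : ∀ i j → ¬ IsBeta N (nu la B i) j → boundaryAt k (nu la B i) j ≡ true
  beta-true i j ¬β with boundaryAt k (nu la B i) j in e
  ... | true  = refl
  ... | false = ⊥-elim (¬β (beta-false⁻ i j e))

  -- Adding the strip with label i+1 moves the north step at position p,
  -- coming from the bottom row b of the strip, to position p + k.
  module AddStrip (i : ℕ) (i<m : suc i ≤ m) where

    μ ν′ : ℕ → ℕ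
    μ = ν i
    ν′ = ν (suc i)

    -- Opaque because unfolding the searches for a and b makes later conversion checks explode.
    opaque
      rowsOfStrip : StripRows k μ ν′ L (Strip la B (suc i))
      rowsOfStrip = stripRows k k>0 μ ν′ L (nu-decreasing i) (nu-decreasing (suc i)) (nu-mono (n≤1+n i))
        (nu-beyond (suc i)) (Strip la B (suc i)) (strip⁻ i) (strip⁺ i) (strips (suc i) (s≤s z≤n) i<m)
    open StripRows rowsOfStrip public

    μ-antitone : ∀ {r r′} → r ≤ r′ → μ r′ ≤ μ r
    μ-antitone = rowLen-antitone (nu la B i) (nu-decreasing i)

    ν′-antitone : ∀ {r r′} → r ≤ r′ → ν′ r′ ≤ ν′ r
    ν′-antitone = rowLen-antitone (nu la B (suc i)) (nu-decreasing (suc i))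

    b<N : b < N
    b<N = <-≤-trans b<L L≤N

    a<N : a < N
    a<N = ≤-<-trans a≤b b<N

    p : ℕ
    p = μ b + N ∸ suc b

    north-p : p + suc b ≡ μ b + N
    north-p = m∸n+n≡m (≤-trans b<N (m≤n+m N (μ b)))

    north-p+k : (p + k) + suc a ≡ ν′ a + N
    north-p+k = +-cancelʳ-≡ b _ _ (begin
      ((p + k) + suc a) + b ≡⟨ shuffle₁ p k a b ⟩
      (p + suc b) + (k + a) ≡⟨ cong (_+ (k + a)) north-p ⟩
      (μ b + N) + (k + a)   ≡⟨ shuffle₂ (μ b) N k a ⟩
      (k + μ b + a) + N     ≡⟨ cong (_+ N) size ⟩
      (ν′ a + b) + N        ≡⟨ shuffle₃ (ν′ a) b N ⟩
      (ν′ a + N) + b        ∎)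
      where
      open ≡-Reasoning
      shuffle₁ : ∀ p k a b → ((p + k) + suc a) + b ≡ (p + suc b) + (k + a)
      shuffle₁ = solve-∀
      shuffle₂ : ∀ x N k a → (x + N) + (k + a) ≡ (k + x + a) + N
      shuffle₂ = solve-∀
      shuffle₃ : ∀ x b N → (x + b) + N ≡ (x + N) + b
      shuffle₃ = solve-∀

    private
      down : ∀ {j r X} → j + suc r ≡ X + N → j + suc (suc r) ≡ suc X + N
      down {j} {r} e = trans (+-suc j (suc r)) (cong suc e)

      up : ∀ {j r X} → j + suc (suc r) ≡ suc X + N → j + suc r ≡ X + N
      up {j} {r} e = suc-injective (trans (sym (+-suc j (suc r))) e)

    p-not-beta-after : ¬ IsBeta N (nu la B (suc i)) p
    p-not-beta-after (r , _ , e) with <-cmp r b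
    ... | tri< r<b _ _ = <-irrefl refl (northStep-<ˡ e north-p (<⇒≤ r<b) (<-≤-trans μb<νb (ν′-antitone (<⇒≤ r<b))))
    ... | tri≈ _ refl _ = <-irrefl refl (northStep-<ˡ e north-p ≤-refl μb<νb)
    ... | tri> _ _ b<r = <-irrefl refl (northStep-<ʳ north-p e b<r (≤-trans (≤-reflexive (below-b r b<r)) (μ-antitone (<⇒≤ b<r))))

    p+k-not-beta-before : ¬ IsBeta N (nu la B i) (p + k)
    p+k-not-beta-before (r , _ , e) with <-cmp r b
    ... | tri> _ _ b<r = <-irrefl refl (≤-<-trans (m≤m+n p k) (northStep-<ʳ north-p e b<r (μ-antitone (<⇒≤ b<r))))
    ... | tri≈ _ refl _ = <-irrefl (sym k≡0) k>0
      where
      k≡0 : k ≡ 0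
      k≡0 = +-cancelˡ-≡ p k 0 (+-cancelʳ-≡ (suc b) (p + k) (p + 0)
              (trans e (trans (sym north-p) (cong (_+ suc b) (sym (+-identityʳ p))))))
    ... | tri< r<b _ _ with <-cmp r a
    ...   | tri< r<a _ _ = <-irrefl refl (northStep-<ʳ (subst (λ x → (p + k) + suc r ≡ x + N) (sym (above-a r r<a)) e)
                                            north-p+k r<a (ν′-antitone (<⇒≤ r<a)))
    ...   | tri≈ _ refl _ = <-irrefl refl (northStep-<ʳ north-p+k (trans (down e) (cong (_+ N) (sym (staircase a ≤-refl r<b))))
                                             (n<1+n a) (ν′-antitone (n≤1+n a)))
    ...   | tri> _ _ a<r = <-irrefl refl (northStep-<ʳ north-p+k (trans (down e) (cong (_+ N) (sym (staircase r (<⇒≤ a<r) r<b))))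
                                            (s≤s (<⇒≤ a<r)) (ν′-antitone (≤-trans (<⇒≤ a<r) (n≤1+n r))))

    beta-after⇒before : ∀ j → IsBeta N (nu la B (suc i)) j → j ≢ p + k → IsBeta N (nu la B i) j
    beta-after⇒before j (r , r<N , e) j≢ with <-cmp r a
    ... | tri< r<a _ _ = r , r<N , trans e (cong (_+ N) (above-a r r<a))
    ... | tri≈ _ refl _ = ⊥-elim (j≢ (+-cancelʳ-≡ (suc a) j (p + k) (trans e (sym north-p+k))))
    ... | tri> _ _ a<r with r
    ...   | suc r′ with <-cmp (suc r′) b
    ...     | tri> _ _ b<r = suc r′ , r<N , trans e (cong (_+ N) (below-b (suc r′) b<r))
    ...     | tri< r<b _ _ = r′ , <-trans (n<1+n r′) r<N , up (trans e (cong (_+ N) (staircase r′ (≤-pred a<r) (<-trans (n<1+n r′) r<b))))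
    ...     | tri≈ _ r≡b _ = r′ , <-trans (n<1+n r′) r<N , up (trans e (cong (_+ N) (staircase r′ (≤-pred a<r) (subst (r′ <_) r≡b (n<1+n r′)))))

    beta-before⇒after : ∀ j → IsBeta N (nu la B i) j → j ≢ p → IsBeta N (nu la B (suc i)) j
    beta-before⇒after j (r , r<N , e) j≢ with <-cmp r b
    ... | tri> _ _ b<r = r , r<N , trans e (cong (_+ N) (sym (below-b r b<r)))
    ... | tri≈ _ refl _ = ⊥-elim (j≢ (+-cancelʳ-≡ (suc b) j p (trans e (sym north-p))))
    ... | tri< r<b _ _ with <-cmp r a
    ...   | tri< r<a _ _ = r , r<N , trans e (cong (_+ N) (sym (above-a r r<a)))
    ...   | tri≈ _ refl _ = suc r , ≤-<-trans r<b b<N , trans (down e) (cong (_+ N) (sym (staircase r ≤-refl r<b)))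
    ...   | tri> _ _ a<r = suc r , ≤-<-trans r<b b<N , trans (down e) (cong (_+ N) (sym (staircase r (<⇒≤ a<r) r<b)))

    before-at-p : boundaryAt k (nu la B i) p ≡ false
    before-at-p = beta-false⁺ i p (b , b<N , north-p)

    before-at-p+k : boundaryAt k (nu la B i) (p + k) ≡ true
    before-at-p+k = beta-true i (p + k) p+k-not-beta-before

    after-at-p : boundaryAt k (nu la B (suc i)) p ≡ true
    after-at-p = beta-true (suc i) p p-not-beta-after

    after-at-p+k : boundaryAt k (nu la B (suc i)) (p + k) ≡ false
    after-at-p+k = beta-false⁺ (suc i) (p + k) (a , a<N , north-p+k)

    boundary-unchanged : ∀ j → j ≢ p → j ≢ p + k → boundaryAt k (nu la B (suc i)) j ≡ boundaryAt k (nu la B i) j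
    boundary-unchanged j j≢p j≢p+k = Bool-≡-from-false
      (λ e → beta-false⁺ i j (beta-after⇒before j (beta-false⁻ (suc i) j e) j≢p+k))
      (λ e → beta-false⁺ (suc i) j (beta-before⇒after j (beta-false⁻ i j e) j≢p))

  Q : ℕ
  Q = suc (sum la + N)

  run : ℕ → ℕ → ℕ → Bool
  run i t = runner k (nu la B i) t

  InQuot : ℕ → ℕ → Cell → Set
  InQuot i t x = InShape (quot k (nu la B i) t) x

  quot-nu : ∀ i t → t < k → quot k (nu la B i) t ≡ shapeOfWord (applyUpTo (run i t) Q)
  quot-nu i t t<k = quot-runner k (nu la B i) t Q t<k k>0 (nu-decreasing i) (begin
    length (boundaryWord k (nu la B i)) ≤⟨ length-boundaryWord k k>0 (nu la B i) (nu-decreasing i) (sum la)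
                                             (λ r → ≤-trans (nu-≤ i r) (rowLen≤sum la r)) ⟩
    sum la + k * length (nu la B i)    ≡⟨ cong (λ n → sum la + k * n) (length-nu i) ⟩
    sum la + N                          <⟨ n<1+n _ ⟩
    Q                                   ≤⟨ m≤n*m Q k ⟩
    k * Q                               ∎)
    where open ≤-Reasoning

  inQuot⁻ : ∀ {i t x} → t < k → InQuot i t x → InShape (shapeOfWord (applyUpTo (run i t) Q)) x
  inQuot⁻ {i} {t} {x} t<k = subst (λ ρ → InShape ρ x) (quot-nu i t t<k)

  inQuot⁺ : ∀ {i t x} → t < k → InShape (shapeOfWord (applyUpTo (run i t) Q)) x → InQuot i t x
  inQuot⁺ {i} {t} {x} t<k = subst (λ ρ → InShape ρ x) (sym (quot-nu i t t<k))

  -- Adding strip i+1 moves one bead of runner s from position q to q + 1.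
  module MoveBead (i : ℕ) (i<m : suc i ≤ m) where

    open AddStrip i i<m public

    s q : ℕ
    s = p % k
    q = p / k

    s<k : s < k
    s<k = m%n<n p k

    p≡ : p ≡ s + k * q
    p≡ = trans (m≡m%n+[m/n]*n p k) (cong (s +_) (*-comm q k))

    p+k≡ : s + k * suc q ≡ p + k
    p+k≡ = trans (shuffle s k q) (cong (_+ k) (sym p≡))
      where
      shuffle : ∀ s k q → s + k * suc q ≡ (s + k * q) + k
      shuffle = solve-∀

    q+2≤Q : suc (suc q) ≤ Q
    q+2≤Q = *-cancelˡ-< k (suc q) Q (begin-strict
      k * suc q        ≤⟨ m≤n+m (k * suc q) s ⟩
      s + k * suc q    ≡⟨ p+k≡ ⟩
      p + k            <⟨ subst (p + k <_) north-p+k (m<m+n (p + k) z<s) ⟩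
      ν′ a + N         ≤⟨ +-monoˡ-≤ N (≤-trans (nu-≤ (suc i) a) (rowLen≤sum la a)) ⟩
      sum la + N       <⟨ n<1+n _ ⟩
      Q                ≤⟨ m≤n*m Q k ⟩
      k * Q            ∎)
      where open ≤-Reasoning

    run-before-q : run i s q ≡ false
    run-before-q = subst (λ j → boundaryAt k (nu la B i) j ≡ false) p≡ before-at-p

    run-before-q+1 : run i s (suc q) ≡ true
    run-before-q+1 = subst (λ j → boundaryAt k (nu la B i) j ≡ true) (sym p+k≡) before-at-p+k

    run-after-q : run (suc i) s q ≡ true
    run-after-q = subst (λ j → boundaryAt k (nu la B (suc i)) j ≡ true) p≡ after-at-p

    run-after-q+1 : run (suc i) s (suc q) ≡ false
    run-after-q+1 = subst (λ j → boundaryAt k (nu la B (suc i)) j ≡ false) (sym p+k≡) after-at-p+k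

    run-same : ∀ j → j ≢ q → j ≢ suc q → run (suc i) s j ≡ run i s j
    run-same j j≢q j≢q+1 = boundary-unchanged (s + k * j)
      (λ e → j≢q (proj₂ (divMod-unique s<k s<k (trans e p≡))))
      (λ e → j≢q+1 (proj₂ (divMod-unique s<k s<k (trans e (sym p+k≡)))))

    run-other : ∀ t → t < k → t ≢ s → ∀ j → run (suc i) t j ≡ run i t j
    run-other t t<k t≢s j = boundary-unchanged (t + k * j)
      (λ e → t≢s (proj₁ (divMod-unique t<k s<k (trans e p≡))))
      (λ e → t≢s (proj₁ (divMod-unique t<k s<k (trans e (sym p+k≡)))))

    private
      e = Q ∸ suc (suc q)

      Q≡ : q + suc (suc e) ≡ Q
      Q≡ = trans (shuffle q e) (m+[n∸m]≡n q+2≤Q)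
        where
        shuffle : ∀ q e → q + suc (suc e) ≡ suc (suc q) + e
        shuffle = solve-∀

      around : ∀ (g : ℕ → Bool) → applyUpTo g Q ≡ applyUpTo g q ++ g q ∷ g (suc q) ∷ applyUpTo (λ j → g (q + suc (suc j))) e
      around g = trans (cong (applyUpTo g) (sym Q≡)) (applyUpTo-around g q e)

    U Z : List Bool
    U = applyUpTo (run i s) q
    Z = applyUpTo (λ j → run i s (q + suc (suc j))) e

    old-word : applyUpTo (run i s) Q ≡ U ++ false ∷ true ∷ Z
    old-word = trans (around (run i s)) (cong₂ (λ x y → U ++ x ∷ y ∷ Z) run-before-q run-before-q+1)

    new-word : applyUpTo (run (suc i) s) Q ≡ U ++ true ∷ false ∷ Z
    new-word = begin
      applyUpTo (run (suc i) s) Q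
        ≡⟨ around (run (suc i) s) ⟩
      applyUpTo (run (suc i) s) q ++ run (suc i) s q ∷ run (suc i) s (suc q) ∷ applyUpTo (λ j → run (suc i) s (q + suc (suc j))) e
        ≡⟨ cong₂ (λ V W → V ++ run (suc i) s q ∷ run (suc i) s (suc q) ∷ W) same-U same-Z ⟩
      U ++ run (suc i) s q ∷ run (suc i) s (suc q) ∷ Z
        ≡⟨ cong₂ (λ x y → U ++ x ∷ y ∷ Z) run-after-q run-after-q+1 ⟩
      U ++ true ∷ false ∷ Z ∎
      where
      open ≡-Reasoning
      same-U : applyUpTo (run (suc i) s) q ≡ U
      same-U = applyUpTo-cong q (λ j j<q → run-same j (<⇒≢ j<q) (λ j≡ → <-asym j<q (subst (q <_) (sym j≡) (n<1+n q))))
      same-Z : applyUpTo (λ j → run (suc i) s (q + suc (suc j))) e ≡ Z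
      same-Z = applyUpTo-cong e (λ j _ → run-same (q + suc (suc j))
        (m+1+n≢m q) (λ e′ → m+1+n≢m (suc q) (trans (sym (+-suc q (suc j))) e′)))

    open SwapNorthEast U Z public

    cell : Cell
    cell = (cellRow , cellCol)

    quot-step⁻ : ∀ t x → t < k → InQuot (suc i) t x → InQuot i t x ⊎ (t ≡ s × x ≡ cell)
    quot-step⁻ t x t<k x∈ with t ≟ s
    ... | yes refl = [ (λ x∈old → inj₁ (inQuot⁺ s<k (subst (λ w → InShape (shapeOfWord w) x) (sym old-word) x∈old)))
                     , (λ x≡ → inj₂ (refl , x≡)) ]′
                     (swap-shape⁻ x (subst (λ w → InShape (shapeOfWord w) x) new-word (inQuot⁻ s<k x∈)))
    ... | no t≢s = inj₁ (inQuot⁺ t<k (subst (λ w → InShape (shapeOfWord w) x)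
                     (applyUpTo-cong Q (λ j _ → run-other t t<k t≢s j)) (inQuot⁻ t<k x∈)))

    quot-step⁺ : ∀ t x → t < k → InQuot i t x → InQuot (suc i) t x
    quot-step⁺ t x t<k x∈ with t ≟ s
    ... | yes refl = inQuot⁺ s<k (subst (λ w → InShape (shapeOfWord w) x) (sym new-word)
                       (swap-shape⁺ x (inj₁ (subst (λ w → InShape (shapeOfWord w) x) old-word (inQuot⁻ s<k x∈)))))
    ... | no t≢s = inQuot⁺ t<k (subst (λ w → InShape (shapeOfWord w) x)
                     (sym (applyUpTo-cong Q (λ j _ → run-other t t<k t≢s j))) (inQuot⁻ t<k x∈))

    quot-step-new : InQuot (suc i) s cell
    quot-step-new = inQuot⁺ s<k (subst (λ w → InShape (shapeOfWord w) cell) (sym new-word) (swap-shape⁺ cell (inj₂ refl)))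

    quot-step-fresh : ¬ InQuot i s cell
    quot-step-fresh cell∈ = swap-cell-fresh (subst (λ w → InShape (shapeOfWord w) cell) old-word (inQuot⁻ s<k cell∈))

    northSteps-step : ∀ t → t < k → northSteps (applyUpTo (run (suc i) t) Q) ≡ northSteps (applyUpTo (run i t) Q)
    northSteps-step t t<k with t ≟ s
    ... | yes refl = begin
      northSteps (applyUpTo (run (suc i) s) Q) ≡⟨ cong northSteps new-word ⟩
      northSteps (U ++ true ∷ false ∷ Z)       ≡⟨ northSteps-swap ⟩
      northSteps (U ++ false ∷ true ∷ Z)       ≡⟨ cong northSteps old-word ⟨
      northSteps (applyUpTo (run i s) Q)       ∎
      where open ≡-Reasoning
    ... | no t≢s = cong northSteps (applyUpTo-cong Q (λ j _ → run-other t t<k t≢s j))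

  -- ν₀ is empty: every runner starts with its L beads at the bottom.

  run-initial-north : ∀ t j → t < k → j < L → run 0 t j ≡ false
  run-initial-north t j t<k j<L = beta-false⁺ 0 x (N ∸ suc x , r<N , north)
    where
    x = t + k * j
    x<N : x < N
    x<N = <-≤-trans (+-monoˡ-< (k * j) t<k) (≤-trans (≤-reflexive (sym (*-suc k j))) (*-monoʳ-≤ k j<L))
    x+r≡N : suc x + (N ∸ suc x) ≡ N
    x+r≡N = m+[n∸m]≡n x<N
    north : x + suc (N ∸ suc x) ≡ ν 0 (N ∸ suc x) + N
    north = trans (trans (+-suc x _) x+r≡N) (cong (_+ N) (sym (nu-empty _)))
    r<N : N ∸ suc x < N
    r<N = subst (suc (N ∸ suc x) ≤_) x+r≡N (s≤s (m≤n+m (N ∸ suc x) x))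

  run-initial-east : ∀ t j → L ≤ j → run 0 t j ≡ true
  run-initial-east t j L≤j = beta-true 0 (t + k * j) λ (r , _ , north) →
    <-irrefl refl (<-≤-trans (subst (t + k * j <_) (trans north (cong (_+ N) (nu-empty r))) (m<m+n _ z<s))
                             (≤-trans (*-monoʳ-≤ k L≤j) (m≤n+m (k * j) t)))

  word-initial : ∀ t → t < k → applyUpTo (run 0 t) Q ≡ replicate L false ++ replicate (Q ∸ L) true
  word-initial t t<k = begin
    applyUpTo (run 0 t) Q
      ≡⟨ cong (applyUpTo (run 0 t)) (m+[n∸m]≡n L≤Q) ⟨
    applyUpTo (run 0 t) (L + (Q ∸ L))
      ≡⟨ applyUpTo-+ (run 0 t) L (Q ∸ L) ⟩
    applyUpTo (run 0 t) L ++ applyUpTo (λ j → run 0 t (L + j)) (Q ∸ L)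
      ≡⟨ cong₂ _++_ (applyUpTo-replicate L (λ j j<L → run-initial-north t j t<k j<L))
                    (applyUpTo-replicate (Q ∸ L) (λ j _ → run-initial-east t (L + j) (m≤m+n L j))) ⟩
    replicate L false ++ replicate (Q ∸ L) true ∎
    where
    open ≡-Reasoning
    L≤Q : L ≤ Q
    L≤Q = ≤-trans L≤N (≤-trans (m≤n+m N (sum la)) (n≤1+n _))

  quot-initial-empty : ∀ t x → t < k → ¬ InQuot 0 t x
  quot-initial-empty t (r , c) t<k c∈ = n≮0 (subst (c <_) empty (inQuot⁻ t<k c∈))
    where
    open ≡-Reasoning
    empty : rowLen (shapeOfWord (applyUpTo (run 0 t) Q)) r ≡ 0
    empty = begin
      rowLen (reverse (wordRows 0 (applyUpTo (run 0 t) Q))) r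
        ≡⟨ cong (λ w → rowLen (reverse (wordRows 0 w)) r) (word-initial t t<k) ⟩
      rowLen (reverse (wordRows 0 (replicate L false ++ replicate (Q ∸ L) true))) r
        ≡⟨ cong (λ ρ → rowLen (reverse ρ) r) (trans (wordRows-++-east 0 (replicate L false) (Q ∸ L)) (wordRows-north L)) ⟩
      rowLen (reverse (replicate L 0)) r
        ≡⟨ cong (λ ρ → rowLen ρ r) (reverse-replicate L 0) ⟩
      rowLen (replicate L 0) r
        ≡⟨ rowLen-replicate-0 L r ⟩
      0 ∎

  northSteps-run : ∀ i → i ≤ m → ∀ t → t < k → northSteps (applyUpTo (run i t) Q) ≡ L
  northSteps-run zero    _   t t<k = begin
    northSteps (applyUpTo (run 0 t) Q)                                     ≡⟨ cong northSteps (word-initial t t<k) ⟩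
    northSteps (replicate L false ++ replicate (Q ∸ L) true)               ≡⟨ northSteps-++ (replicate L false) _ ⟩
    northSteps (replicate L false) + northSteps (replicate (Q ∸ L) true)   ≡⟨ cong₂ _+_ (northSteps-north L) (northSteps-east (Q ∸ L)) ⟩
    L + 0                                                                  ≡⟨ +-identityʳ L ⟩
    L                                                                      ∎
    where open ≡-Reasoning
  northSteps-run (suc i) i<m t t<k = trans (MoveBead.northSteps-step i i<m t t<k) (northSteps-run i (<⇒≤ i<m) t t<k)

  cell-diagonal : ∀ i (i<m : suc i ≤ m) → let open MoveBead i i<m in cellCol + L ≡ suc (q + cellRow)
  cell-diagonal i i<m = subst (λ n → cellCol + n ≡ suc (q + cellRow))
    (trans (sym (cong northSteps old-word)) (northSteps-run i (<⇒≤ i<m) s s<k))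
    (subst (λ n → cellCol + northSteps (U ++ false ∷ true ∷ Z) ≡ suc (n + cellRow)) (length-applyUpTo (run i s) q) swap-cell-diagonal)
    where open MoveBead i i<m

  quot-mono : ∀ {i j t x} → i ≤ j → j ≤ m → t < k → InQuot i t x → InQuot j t x
  quot-mono {i} {zero}  z≤n _ _ x∈ = x∈
  quot-mono {i} {suc j} i≤j j<m t<k x∈ with m≤n⇒m<n∨m≡n i≤j
  ... | inj₂ refl = x∈
  ... | inj₁ i<1+j = MoveBead.quot-step⁺ j j<m _ _ t<k (quot-mono (≤-pred i<1+j) (<⇒≤ j<m) t<k x∈)

  private
    inQuotᵇ : ℕ → Cell → ℕ → Bool
    inQuotᵇ t x i = inShapeᵇ (quot k (nu la B i) t) x

    inQuotᵇ⁻ : ∀ t x i → inQuotᵇ t x i ≡ true → InQuot i t x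
    inQuotᵇ⁻ t (r , c) i e = <ᵇ⇒< c _ (Equivalence.from T-≡ e)

    inQuotᵇ⁺ : ∀ t x i → InQuot i t x → inQuotᵇ t x i ≡ true
    inQuotᵇ⁺ t (r , c) i x∈ = Equivalence.to T-≡ (<⇒<ᵇ x∈)

    inQuotᵇ-false : ∀ t x i → ¬ InQuot i t x → inQuotᵇ t x i ≡ false
    inQuotᵇ-false t x i x∉ with inQuotᵇ t x i in e
    ... | true  = ⊥-elim (x∉ (inQuotᵇ⁻ t x i e))
    ... | false = refl

    inQuotᵇ-mono : ∀ t x → t < k → ∀ i j → i ≤ j → j ≤ m → inQuotᵇ t x i ≡ true → inQuotᵇ t x j ≡ true
    inQuotᵇ-mono t x t<k i j i≤j j≤m e = inQuotᵇ⁺ t x j (quot-mono i≤j j≤m t<k (inQuotᵇ⁻ t x i e))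

  inQuot-full : ∀ t x → InShape (quot k la t) x → InQuot m t x
  inQuot-full t x = subst (λ ρ → InShape (quot k ρ t) x) (sym nu-full)

  module AddCell (i : ℕ) (i<m : suc i ≤ m) where

    open MoveBead i i<m public

    label⁻ : ∀ t x → t < k → lqLabel k m la B t x ≡ suc i → t ≡ s × x ≡ cell
    label⁻ t x t<k e with firstFrom-switch⁻ (inQuotᵇ t x) m (inQuotᵇ-mono t x t<k) i i<m e
    ... | (on , off) with quot-step⁻ t x t<k (inQuotᵇ⁻ t x (suc i) on)
    ...   | inj₂ t,x≡ = t,x≡
    ...   | inj₁ x∈ with trans (sym off) (inQuotᵇ⁺ t x i x∈)
    ...     | ()

    label-cell : lqLabel k m la B s cell ≡ suc i
    label-cell = firstFrom-switch⁺ (inQuotᵇ s cell) m (inQuotᵇ-mono s cell s<k) i i<m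
      (inQuotᵇ⁺ s cell (suc i) quot-step-new) (inQuotᵇ-false s cell i quot-step-fresh)

    cell-in-quot : InShape (quot k la s) cell
    cell-in-quot = subst (λ ρ → InShape (quot k ρ s) cell) nu-full (quot-mono i<m ≤-refl s<k quot-step-new)

    tail-bottom : IsTail (Strip la B (suc i)) (b , μ b)
    tail-bottom = strip⁺ i b (μ b) μb<νb ≤-refl , λ where
      (r , c) Src → let (_ , μ≤c) = strip⁻ i r c Src ; (_ , r≤b) = rows r c Src in
        content-≤⁺ b (μ b) r c (+-mono-≤ (≤-trans (μ-antitone r≤b) μ≤c) r≤b)

    tail-row : ∀ x → IsTail (Strip la B (suc i)) x → row x ≡ b
    tail-row (r , c) (Src , least) = ≤-antisym r≤b (≮⇒≥ λ r<b →
      <-irrefl refl (≤-<-trans (content-≤⁻ r c b (μ b) (least (b , μ b) (proj₁ tail-bottom)))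
                               (+-mono-≤-< (≤-trans (μ-antitone (<⇒≤ r<b)) μ≤c) r<b)))
      where
      r≤b = proj₂ (rows r c Src)
      μ≤c = proj₂ (strip⁻ i r c Src)

  -- Descents: both kinds compare the positions p of consecutive strips.

  module Consecutive (i : ℕ) (i+1<m : suc (suc i) ≤ m) where

    module S₁ = AddCell i (≤-trans (n≤1+n (suc i)) i+1<m)
    module S₂ = AddCell (suc i) i+1<m

    lower-tail : S₁.b < S₂.b → S₂.p < S₁.p
    lower-tail b₁<b₂ = northStep-<ʳ S₁.north-p S₂.north-p b₁<b₂ (begin
      S₂.μ S₂.b          ≤⟨ S₁.ν′-antitone b₁<b₂ ⟩
      S₁.ν′ (suc S₁.b)   ≡⟨ S₁.below-b (suc S₁.b) (n<1+n S₁.b) ⟩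
      S₁.μ (suc S₁.b)    ≤⟨ nu-decreasing i S₁.b ⟩
      S₁.μ S₁.b          ∎)
      where open ≤-Reasoning

    not-lower-tail : S₂.b ≤ S₁.b → S₁.p < S₂.p
    not-lower-tail b₂≤b₁ = northStep-<ˡ S₂.north-p S₁.north-p b₂≤b₁ (<-≤-trans S₁.μb<νb (S₁.ν′-antitone b₂≤b₁))

    desB⁻ : DesB m la B (suc i) → S₂.p < S₁.p
    desB⁻ (_ , _ , x , y , tail-x , tail-y , x<y) = lower-tail (subst₂ _<_ (S₁.tail-row x tail-x) (S₂.tail-row y tail-y) x<y)

    desB⁺ : S₂.p < S₁.p → DesB m la B (suc i)
    desB⁺ p₂<p₁ = s≤s z≤n , i+1<m , (S₁.b , S₁.μ S₁.b) , (S₂.b , S₂.μ S₂.b) , S₁.tail-bottom , S₂.tail-bottom ,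
      ≰⇒> (λ b₂≤b₁ → <-asym p₂<p₁ (not-lower-tail b₂≤b₁))

    private
      Order : ℕ → ℕ → Cell → Cell → Set
      Order s t x y = (s ≤ t × content y ℤ.< content x) ⊎ (t < s × content y ℤ.≤ content x)

      order⇔ : Order S₁.s S₂.s S₁.cell S₂.cell ⇔ ((S₁.s ≤ S₂.s × S₂.q < S₁.q) ⊎ (S₂.s < S₁.s × S₂.q ≤ S₁.q))
      order⇔ = mk⇔ (Sum.map (Product.map₂ (Equivalence.to <⇔)) (Product.map₂ (Equivalence.to ≤⇔)))
                   (Sum.map (Product.map₂ (Equivalence.from <⇔)) (Product.map₂ (Equivalence.from ≤⇔)))
        where
        <⇔ = content-diagonal-< (cell-diagonal i (≤-trans (n≤1+n (suc i)) i+1<m)) (cell-diagonal (suc i) i+1<m)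
        ≤⇔ = content-diagonal-≤ (cell-diagonal i (≤-trans (n≤1+n (suc i)) i+1<m)) (cell-diagonal (suc i) i+1<m)

      positions : (S₂.s + k * S₂.q < S₁.s + k * S₁.q) ≡ (S₂.p < S₁.p)
      positions = sym (cong₂ _<_ S₂.p≡ S₁.p≡)

      transport : ∀ {s t x y} → s ≡ S₁.s × x ≡ S₁.cell → t ≡ S₂.s × y ≡ S₂.cell →
        Order s t x y → Order S₁.s S₂.s S₁.cell S₂.cell
      transport (refl , refl) (refl , refl) order = order

    desT⁻ : DesT k m la B (suc i) → S₂.p < S₁.p
    desT⁻ (_ , _ , s , t , x , y , s<k , t<k , _ , label-x , _ , label-y , order) =
      subst (λ P → P) positions (lexicographic-<⁺ S₂.s<k (Equivalence.to order⇔
        (transport (S₁.label⁻ s x s<k label-x) (S₂.label⁻ t y t<k label-y) order)))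

    desT⁺ : S₂.p < S₁.p → DesT k m la B (suc i)
    desT⁺ p₂<p₁ = s≤s z≤n , i+1<m , S₁.s , S₂.s , S₁.cell , S₂.cell , S₁.s<k , S₂.s<k ,
      S₁.cell-in-quot , S₁.label-cell , S₂.cell-in-quot , S₂.label-cell ,
      Equivalence.from order⇔ (lexicographic-<⁻ S₁.s<k (subst (λ P → P) (sym positions) p₂<p₁))

  descents : ∀ i → DesB m la B i ⇔ DesT k m la B i
  descents zero    = mk⇔ (λ ()) (λ ())
  descents (suc i) = mk⇔ to from
    where
    to : DesB m la B (suc i) → DesT k m la B (suc i)
    to desB@(_ , i+1<m , _) = let open Consecutive i i+1<m in desT⁺ (desB⁻ desB)
    from : DesT k m la B (suc i) → DesB m la B (suc i)
    from desT@(_ , i+1<m , _) = let open Consecutive i i+1<m in desB⁺ (desT⁻ desT)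

  -- The first strip starts in the top row at the first column, so its
  -- bottom row b is its height and its bead ends at position N - 1 - b.

  module FirstStrip (0<m : 1 ≤ m) where

    open AddCell 0 0<m public

    a≡0 : a ≡ 0
    a≡0 = n≤0⇒n≡0 (≮⇒≥ λ 0<a → n≮0 (begin-strict
      0          ≡⟨ nu-empty a ⟨
      μ a        <⟨ μa<νa ⟩
      ν′ a       ≤⟨ ν′-antitone z≤n ⟩
      ν′ 0       ≡⟨ above-a 0 0<a ⟩
      μ 0        ≡⟨ nu-empty 0 ⟩
      0          ∎))
      where open ≤-Reasoning

    k≡ : k ≡ ν′ 0 + b
    k≡ = begin
      k                ≡⟨ trans (+-identityʳ (k + 0)) (+-identityʳ k) ⟨
      k + 0 + 0        ≡⟨ cong₂ (λ x y → k + x + y) (sym (nu-empty b)) (sym a≡0) ⟩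
      k + μ b + a      ≡⟨ size ⟩
      ν′ a + b         ≡⟨ cong (λ r → ν′ r + b) a≡0 ⟩
      ν′ 0 + b         ∎
      where open ≡-Reasoning

    b<k : b < k
    b<k = subst (b <_) (sym k≡) (+-monoˡ-≤ b (subst (λ r → 0 < ν′ r) a≡0 (subst (_< ν′ a) (nu-empty a) μa<νa)))

    s≡ : s ≡ k ∸ 1 ∸ b
    s≡ = remainder-of-complement b<k b<L s<k (begin
      (s + k * q) + suc b ≡⟨ cong (_+ suc b) p≡ ⟨
      p + suc b           ≡⟨ north-p ⟩
      μ b + N             ≡⟨ cong (_+ N) (nu-empty b) ⟩
      N                   ∎)
      where open ≡-Reasoning

    height : HasHeight (Strip la B 1) b
    height = upTo (suc b) , upTo⁺ (suc b) , (λ r → mk⇔ (λ r∈ → 0 , first-column r (≤-pred (∈-upTo⁻ r∈)))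
                                                       (λ (c , Src) → ∈-upTo⁺ (s≤s (proj₂ (rows r c Src))))) ,
             length-upTo (suc b)
      where
      first-column : ∀ r → r ≤ b → Strip la B 1 (r , 0)
      first-column r r≤b = strip⁺ 0 r 0 (subst (_< ν′ r) (nu-empty r) occupied) (≤-reflexive (nu-empty r))
        where
        occupied : μ r < ν′ r
        occupied with m≤n⇒m<n∨m≡n r≤b
        ... | inj₂ refl = μb<νb
        ... | inj₁ r<b = <-≤-trans (subst (μ r <_) (sym (staircase r (subst (_≤ r) (sym a≡0) z≤n) r<b)) (n<1+n (μ r)))
                                   (nu-decreasing 1 r)

  height-of-first-strip : ∀ s′ → s′ < k → (∃ λ x → InShape (quot k la s′) x × lqLabel k m la B s′ x ≡ 1) →
    HasHeight (Strip la B 1) (k ∸ 1 ∸ s′)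
  height-of-first-strip s′ s′<k (x , x∈ , label-x) with 1 ≤? m
  ... | no m≡0 = ⊥-elim (quot-initial-empty s′ x s′<k
                  (subst (λ i → InQuot i s′ x) (n<1⇒n≡0 (≰⇒> m≡0)) (inQuot-full s′ x x∈)))
  ... | yes 0<m = subst (HasHeight (Strip la B 1)) (sym k-1-s≡b) height
    where
    open FirstStrip 0<m
    k-1-s≡b : k ∸ 1 ∸ s′ ≡ b
    k-1-s≡b = trans (cong (k ∸ 1 ∸_) (trans (proj₁ (label⁻ s′ x s′<k label-x)) s≡)) (m∸[m∸n]≡n (<⇒≤pred b<k))

lemma3p6 : (k : ℕ) .{{_ : NonZero k}} (la : List ℕ) → IsPartition la →
    k ∣ sum la → IsKCore k la [] →
    (B : Cell → ℕ) → IsBST k (sum la / k) la B →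
    (∀ i → DesB (sum la / k) la B i ⇔ DesT k (sum la / k) la B i) ×
    (∀ s → s < k →
      (∃ λ a → InShape (quot k la s) a × lqLabel k (sum la / k) la B s a ≡ 1) →
      HasHeight (Strip la B 1) (k ∸ 1 ∸ s))
lemma3p6 k la partition _ _ B bst =
  Tableau.descents k la B (sum la / k) partition bst ,
  Tableau.height-of-first-strip k la B (sum la / k) partition bst
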